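{- Let $m\geq 3$ be an integer. For a finite set $P\subset\mathbb{R}^m$ let $E_2(P)=|\{(p_1,q_1,p_2,q_2)\in P^4: d(p_1,q_1)=d(p_2,q_2)\}|$, where $d$ is the Euclidean distance. For a positive integer $N$ let $P_N=[\sqrt[m]{N}]^m\subset\mathbb{R}^m$, where $[x]=\{1,2,\dots,\lfloor x\rfloor\}$. Then \[N^{2+\frac{2m-2}{m}}\lesssim_m E_2(P_N)\lesssim_m N^{2+\frac{2m-2}{m}}.\]
   Context: The notation $A\lesssim_m B$ means $A\leq C_m B$ for a constant $C_m>0$ depending only on $m$ (uniformly in $N$). -}

module Defs where

open import Data.Nat using (ℕ; zero; suc; _+_; _*_; ∣_-_∣; _≡ᵇ_)
open import Data.Bool using (if_then_else_)
open import Data.Fin using (Fin; toℕ)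
open import Data.Vec using (Vec; []; _∷_)
open import Data.List using (List; []; _∷_; concatMap; map; allFin)
open import Data.Nat.ListAction using (sum)

-- The grid [k]^m: all points of {1,…,k}^m, encoded as vectors of Fin k
-- (index i : Fin k stands for the integer coordinate 1 + toℕ i).
grid : (m k : ℕ) → List (Vec (Fin k) m)
grid zero    k = [] ∷ []
grid (suc m) k = concatMap (λ i → map (i ∷_) (grid m k)) (allFin k)

coord : {k : ℕ} → Fin k → ℕ
coord i = suc (toℕ i)

sqDist : {m k : ℕ} → Vec (Fin k) m → Vec (Fin k) m → ℕ
sqDist []       []       = 0
sqDist (x ∷ xs) (y ∷ ys) = ∣ coord x - coord y ∣ * ∣ coord x - coord y ∣ + sqDist xs ys

-- E₂([k]^m) = #{(p₁,q₁,p₂,q₂) ∈ P⁴ : d(p₁,q₁) = d(p₂,q₂)}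
-- (equality of distances ⇔ equality of squared distances).
E2 : (m k : ℕ) → ℕ
E2 m k = sum (concatMap (λ p₁ → concatMap (λ q₁ → concatMap (λ p₂ → map (λ q₂ →
           if sqDist p₁ q₁ ≡ᵇ sqDist p₂ q₂ then 1 else 0) P) P) P) P)
  where P = grid m k

-- Write E for E₂([k]^m) and ν(r) for the number of pairs at squared distance r.  Lower bound: the
-- squared distances take at most mk² + 1 values, so by Cauchy–Schwarz
-- k^(4m) = (∑ ν)² ≤ (mk² + 1) ∑ ν² = (mk² + 1) E.  Upper bound: counting quadruples with
-- A + |p₁ - q₁|² = B + |p₂ - q₂|² for arbitrary shifts A, B, one more coordinate costs at most a
-- factor k⁴, so it suffices to show E ≲ k¹⁰ for m = 3.  There, passing to difference vectors
-- a, d ∈ [0,k)³ and setting x = a + d, the condition becomes a linear equation x·a = c, which has at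
-- most k² gcd(x)/max(x) + 2k + 1 solutions a in the box: the a₃ are unique, the a₂ are spaced by
-- x₃/gcd(x₂,x₃), the a₁ by gcd(x₂,x₃)/gcd(x). Expanding gcd(x) over common divisors d, the sum over
-- x ∈ [0,2k)³ is O(k⁴ ∑ 1/d²) = O(k⁴).  Finally k^m ≤ N < (2k)^m turns E ≍ k^(4m-2) into the claim.
module Submission where

open import Defs
open import Data.Nat
open import Data.Nat.Properties
open import Algebra.Properties.CommutativeSemigroup +-commutativeSemigroup using () renaming (interchange to +-interchange; xy∙z≈xz∙y to +-right-comm)
open import Algebra.Properties.CommutativeSemigroup *-commutativeSemigroup using (x∙yz≈y∙xz; x∙yz≈y∙zx; x∙yz≈yx∙z) renaming (xy∙z≈xz∙y to *-right-comm)
open import Data.Nat.Divisibility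
open import Data.Nat.DivMod
open import Data.Nat.GCD
open import Data.Nat.Coprimality using (coprime-divisor; coprime-/gcd) renaming (sym to coprime-sym)
open import Data.Nat.Induction using (<-rec)
open import Data.Nat.Tactic.RingSolver
open import Data.Nat.ListAction using (sum)
open import Data.Nat.ListAction.Properties using (sum-++)
open import Data.Bool using (if_then_else_)
open import Data.Fin using (Fin; toℕ)
import Data.Fin as Fin
open import Data.Fin.Properties using (toℕ<n)
open import Data.List using (List; []; _∷_; map; concatMap; allFin; tabulate; _++_)
open import Data.List.Properties using (map-tabulate)
open import Data.Vec using (Vec; []; _∷_)
open import Data.Product using (Σ; _×_; _,_; ∃)
open import Data.Sum using (_⊎_; inj₁; inj₂; [_,_]′)
open import Data.Empty using (⊥-elim)
open import Function using (_∘_)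
open import Relation.Nullary using (Dec; yes; no; does; ¬_)
open import Relation.Binary.PropositionalEquality

≤1-cases : ∀ {n} → n ≤ 1 → n ≡ 0 ⊎ n ≡ 1
≤1-cases z≤n       = inj₁ refl
≤1-cases (s≤s z≤n) = inj₂ refl

2mn≤m²+n² : ∀ m n → 2 * m * n ≤ m * m + n * n
2mn≤m²+n² m n = [ ordered , (λ n≤m → subst₂ _≤_ (*-right-comm 2 n m) (+-comm (n * n) (m * m)) (ordered n≤m)) ]′ (≤-total m n)
  where
  ordered : ∀ {m n} → m ≤ n → 2 * m * n ≤ m * m + n * n
  ordered {m} m≤n with m≤n⇒∃[o]m+o≡n m≤n
  ... | d , refl = ≤-trans (m≤m+n _ (d * d)) (≤-reflexive (square-of-sum m d))
    where square-of-sum : ∀ m d → 2 * m * (m + d) + d * d ≡ m * m + (m + d) * (m + d)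
          square-of-sum = solve-∀

^-distribʳ-* : ∀ a b n → (a * b) ^ n ≡ a ^ n * b ^ n
^-distribʳ-* a b zero    = refl
^-distribʳ-* a b (suc n) = trans (cong (a * b *_) (^-distribʳ-* a b n)) (interchange′ a b (a ^ n) (b ^ n))
  where interchange′ : ∀ a b x y → a * b * (x * y) ≡ a * x * (b * y)
        interchange′ = solve-∀

^-swap : ∀ k a b → (k ^ a) ^ b ≡ (k ^ b) ^ a
^-swap k a b = trans (^-*-assoc k a b) (trans (cong (k ^_) (*-comm a b)) (sym (^-*-assoc k b a)))

^-4* : ∀ k m → k ^ (4 * m) ≡ (k ^ m * k ^ m) * (k ^ m * k ^ m)
^-4* k m = trans (cong (k ^_) (*-comm 4 m)) (trans (sym (^-*-assoc k m 4)) (fourth (k ^ m)))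
  where fourth : ∀ x → x * (x * (x * (x * 1))) ≡ (x * x) * (x * x)
        fourth = solve-∀

half : ∀ {A L T} → A + 2 * L ≡ T → L ≡ (T ∸ A) / 2
half {A} {L} refl = sym (trans (cong (_/ 2) (m+n∸m≡n A (2 * L))) (trans (cong (_/ 2) (*-comm 2 L)) (m*n/n≡m L 2)))

m*n≤o⇒m≤o/n : ∀ m n o .{{_ : NonZero n}} → m * n ≤ o → m ≤ o / n
m*n≤o⇒m≤o/n m n o le = subst (_≤ o / n) (m*n/n≡m m n) (/-monoˡ-≤ n le)

gcd≢0ʳ : ∀ m n .{{_ : NonZero n}} → NonZero (gcd m n)
gcd≢0ʳ m n = ≢-nonZero (gcd[m,n]≢0 m n (inj₂ (≢-nonZero⁻¹ n)))

n∣m*o⇒n/gcd[m,n]∣o : ∀ m n o .{{_ : NonZero (gcd m n)}} → n ∣ m * o → n / gcd m n ∣ o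
n∣m*o⇒n/gcd[m,n]∣o m n o n∣mo = coprime-divisor (coprime-sym (coprime-/gcd m n)) (*-cancelˡ-∣ g (subst₂ _∣_ n≡ mo≡ n∣mo))
  where
  g = gcd m n
  n≡ : n ≡ g * (n / g)
  n≡ = trans (sym (m/n*n≡m (gcd[m,n]∣n m n))) (*-comm (n / g) g)
  mo≡ : m * o ≡ g * (m / g * o)
  mo≡ = trans (cong (_* o) (sym (m/n*n≡m (gcd[m,n]∣m m n)))) (trans (*-assoc (m / g) g o) (x∙yz≈y∙xz (m / g) g o))

∣-of-equal-sums : ∀ {d m t t' u v} → t ≤ t' → m * t + u ≡ m * t' + v → d ∣ u → d ∣ v → d ∣ m * (t' ∸ t)
∣-of-equal-sums {d} {m} {t} {t'} {u} {v} t≤t' eq d∣u d∣v = ∣m+n∣m⇒∣n (subst (d ∣_) u≡ d∣u) d∣v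
  where
  u≡ : u ≡ v + m * (t' ∸ t)
  u≡ = +-cancelˡ-≡ (m * t) _ _ (begin
    m * t + u                     ≡⟨ eq ⟩
    m * t' + v                    ≡⟨ cong (λ x → m * x + v) (m+[n∸m]≡n t≤t') ⟨
    m * (t + (t' ∸ t)) + v        ≡⟨ cong (_+ v) (*-distribˡ-+ m t _) ⟩
    m * t + m * (t' ∸ t) + v      ≡⟨ +-assoc (m * t) _ v ⟩
    m * t + (m * (t' ∸ t) + v)    ≡⟨ cong (m * t +_) (+-comm _ v) ⟩
    m * t + (v + m * (t' ∸ t))    ∎)
    where open ≡-Reasoning

[n+b][n+a]≤n²+[2n+1]ab : ∀ n a b → 1 ≤ a → 1 ≤ b → (n + b) * (n + a) ≤ n * n + (2 * n + 1) * (a * b)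
[n+b][n+a]≤n²+[2n+1]ab n a b 1≤a 1≤b = begin
    (n + b) * (n + a)                     ≡⟨ expand n a b ⟩
    n * n + n * a + n * b + a * b         ≤⟨ +-monoˡ-≤ (a * b) (+-mono-≤ (+-monoʳ-≤ (n * n) (*-monoʳ-≤ n a≤ab)) (*-monoʳ-≤ n b≤ab)) ⟩
    n * n + n * (a * b) + n * (a * b) + a * b ≡⟨ collect n (a * b) ⟩
    n * n + (2 * n + 1) * (a * b)         ∎
  where
  open ≤-Reasoning
  a≤ab : a ≤ a * b
  a≤ab = m≤m*n a b {{>-nonZero 1≤b}}
  b≤ab : b ≤ a * b
  b≤ab = m≤n*m b a {{>-nonZero 1≤a}}
  expand : ∀ n a b → (n + b) * (n + a) ≡ n * n + n * a + n * b + a * b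
  expand = solve-∀
  collect : ∀ n p → n * n + n * p + n * p + p ≡ n * n + (2 * n + 1) * p
  collect = solve-∀

𝟙 : {P : Set} → Dec P → ℕ
𝟙 P? = if does P? then 1 else 0

module _ {P : Set} where

  𝟙≤1 : (P? : Dec P) → 𝟙 P? ≤ 1
  𝟙≤1 (yes _) = ≤-refl
  𝟙≤1 (no _)  = z≤n

  𝟙-yes : (P? : Dec P) → P → 𝟙 P? ≡ 1
  𝟙-yes (yes _) _ = refl
  𝟙-yes (no ¬p) p = ⊥-elim (¬p p)

  𝟙-no : (P? : Dec P) → ¬ P → 𝟙 P? ≡ 0
  𝟙-no (yes p) ¬p = ⊥-elim (¬p p)
  𝟙-no (no _)  _  = refl

  𝟙-witness : (P? : Dec P) → 1 ≤ 𝟙 P? → P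
  𝟙-witness (yes p) _ = p

𝟙-mono : {P Q : Set} (P? : Dec P) (Q? : Dec Q) → (P → Q) → 𝟙 P? ≤ 𝟙 Q?
𝟙-mono (yes p) Q? P⇒Q = ≤-reflexive (sym (𝟙-yes Q? (P⇒Q p)))
𝟙-mono (no _)  Q? _   = z≤n

𝟙-cong : {P Q : Set} (P? : Dec P) (Q? : Dec Q) → (P → Q) → (Q → P) → 𝟙 P? ≡ 𝟙 Q?
𝟙-cong P? Q? P⇒Q Q⇒P = ≤-antisym (𝟙-mono P? Q? P⇒Q) (𝟙-mono Q? P? Q⇒P)

∑ : ℕ → (ℕ → ℕ) → ℕ
∑ zero    f = 0
∑ (suc n) f = f 0 + ∑ n (f ∘ suc)

∑-cong-< : ∀ n {f g : ℕ → ℕ} → (∀ i → i < n → f i ≡ g i) → ∑ n f ≡ ∑ n g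
∑-cong-< zero    eq = refl
∑-cong-< (suc n) eq = cong₂ _+_ (eq 0 z<s) (∑-cong-< n (λ i i<n → eq (suc i) (s<s i<n)))

∑-cong : ∀ n {f g : ℕ → ℕ} → (∀ i → f i ≡ g i) → ∑ n f ≡ ∑ n g
∑-cong n eq = ∑-cong-< n (λ i _ → eq i)

∑-mono-< : ∀ n {f g : ℕ → ℕ} → (∀ i → i < n → f i ≤ g i) → ∑ n f ≤ ∑ n g
∑-mono-< zero    le = z≤n
∑-mono-< (suc n) le = +-mono-≤ (le 0 z<s) (∑-mono-< n (λ i i<n → le (suc i) (s<s i<n)))

∑-mono : ∀ n {f g : ℕ → ℕ} → (∀ i → f i ≤ g i) → ∑ n f ≤ ∑ n g
∑-mono n le = ∑-mono-< n (λ i _ → le i)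

∑-+ : ∀ n (f g : ℕ → ℕ) → ∑ n (λ i → f i + g i) ≡ ∑ n f + ∑ n g
∑-+ zero    f g = refl
∑-+ (suc n) f g = trans (cong (f 0 + g 0 +_) (∑-+ n (f ∘ suc) (g ∘ suc))) (+-interchange (f 0) (g 0) _ _)

∑-*ˡ : ∀ n c (f : ℕ → ℕ) → ∑ n (λ i → c * f i) ≡ c * ∑ n f
∑-*ˡ zero    c f = sym (*-zeroʳ c)
∑-*ˡ (suc n) c f = trans (cong (c * f 0 +_) (∑-*ˡ n c (f ∘ suc))) (sym (*-distribˡ-+ c (f 0) _))

∑-*ʳ : ∀ n c (f : ℕ → ℕ) → ∑ n (λ i → f i * c) ≡ ∑ n f * c
∑-*ʳ n c f = trans (∑-cong n (λ i → *-comm (f i) c)) (trans (∑-*ˡ n c f) (*-comm c _))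

∑-const : ∀ n c → ∑ n (λ _ → c) ≡ n * c
∑-const zero    c = refl
∑-const (suc n) c = cong (c +_) (∑-const n c)

∑-zero : ∀ n → ∑ n (λ _ → 0) ≡ 0
∑-zero n = trans (∑-const n 0) (*-zeroʳ n)

∑-≤-const : ∀ n c {f : ℕ → ℕ} → (∀ i → i < n → f i ≤ c) → ∑ n f ≤ n * c
∑-≤-const n c le = ≤-trans (∑-mono-< n le) (≤-reflexive (∑-const n c))

∑-comm : ∀ n m (f : ℕ → ℕ → ℕ) → ∑ n (λ i → ∑ m (f i)) ≡ ∑ m (λ j → ∑ n (λ i → f i j))
∑-comm zero    m f = sym (∑-zero m)
∑-comm (suc n) m f = begin
    ∑ m (f 0) + ∑ n (λ i → ∑ m (f (suc i)))        ≡⟨ cong (∑ m (f 0) +_) (∑-comm n m (f ∘ suc)) ⟩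
    ∑ m (f 0) + ∑ m (λ j → ∑ n (λ i → f (suc i) j)) ≡⟨ ∑-+ m (f 0) _ ⟨
    ∑ m (λ j → ∑ (suc n) (λ i → f i j))            ∎
  where open ≡-Reasoning

∑-split : ∀ a n (f : ℕ → ℕ) → ∑ (a + n) f ≡ ∑ a f + ∑ n (λ i → f (a + i))
∑-split zero    n f = refl
∑-split (suc a) n f = trans (cong (f 0 +_) (∑-split a n (f ∘ suc))) (sym (+-assoc (f 0) _ _))

∑-mono-length : ∀ {n m} (f : ℕ → ℕ) → n ≤ m → ∑ n f ≤ ∑ m f
∑-mono-length {n} {m} f n≤m = begin
    ∑ n f                                ≤⟨ m≤m+n _ _ ⟩
    ∑ n f + ∑ (m ∸ n) (λ i → f (n + i)) ≡⟨ ∑-split n (m ∸ n) f ⟨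
    ∑ (n + (m ∸ n)) f                    ≡⟨ cong (λ l → ∑ l f) (m+[n∸m]≡n n≤m) ⟩
    ∑ m f                                ∎
  where open ≤-Reasoning

term≤∑ : ∀ n (f : ℕ → ℕ) {i} → i < n → f i ≤ ∑ n f
term≤∑ (suc n) f {zero}  _         = m≤m+n _ _
term≤∑ (suc n) f {suc i} (s≤s i<n) = ≤-trans (term≤∑ n (f ∘ suc) i<n) (m≤n+m _ _)

∑-pos : ∀ n (f : ℕ → ℕ) → 1 ≤ ∑ n f → ∃ λ i → 1 ≤ f i
∑-pos (suc n) f pos with f 0 in eq
... | suc _ = 0 , ≤-trans (s≤s z≤n) (≤-reflexive (sym eq))
... | zero with ∑-pos n (f ∘ suc) pos
...   | i , fi = suc i , fi

∑-𝟙≡ : ∀ R a (g : ℕ → ℕ) → a < R → ∑ R (λ r → 𝟙 (a ≟ r) * g r) ≡ g a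
∑-𝟙≡ (suc R) zero    g _ = begin
    g 0 + 0 + ∑ R (λ r → 𝟙 (0 ≟ suc r) * g (suc r)) ≡⟨ cong (g 0 + 0 +_) (trans (∑-cong R λ r → cong (_* g (suc r)) (𝟙-no (0 ≟ suc r) λ ())) (∑-zero R)) ⟩
    g 0 + 0 + 0                                      ≡⟨ trans (+-identityʳ _) (+-identityʳ _) ⟩
    g 0                                              ∎
  where open ≡-Reasoning
∑-𝟙≡ (suc R) (suc a) g (s≤s a<R) =
  trans (cong (λ x → x * g 0 + ∑ R (λ r → 𝟙 (a ≟ r) * g (suc r))) (𝟙-no (suc a ≟ 0) λ ())) (∑-𝟙≡ R a (g ∘ suc) a<R)

∑ₗ : {A : Set} → List A → (A → ℕ) → ℕ
∑ₗ []       f = 0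
∑ₗ (x ∷ xs) f = f x + ∑ₗ xs f

module _ {A : Set} where

  ∑ₗ-cong : (xs : List A) {f g : A → ℕ} → (∀ x → f x ≡ g x) → ∑ₗ xs f ≡ ∑ₗ xs g
  ∑ₗ-cong []       eq = refl
  ∑ₗ-cong (x ∷ xs) eq = cong₂ _+_ (eq x) (∑ₗ-cong xs eq)

  ∑ₗ-mono : (xs : List A) {f g : A → ℕ} → (∀ x → f x ≤ g x) → ∑ₗ xs f ≤ ∑ₗ xs g
  ∑ₗ-mono []       le = z≤n
  ∑ₗ-mono (x ∷ xs) le = +-mono-≤ (le x) (∑ₗ-mono xs le)

  ∑ₗ-zero : (xs : List A) → ∑ₗ xs (λ _ → 0) ≡ 0
  ∑ₗ-zero []       = refl
  ∑ₗ-zero (_ ∷ xs) = ∑ₗ-zero xs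

  ∑ₗ-+ : (xs : List A) (f g : A → ℕ) → ∑ₗ xs (λ x → f x + g x) ≡ ∑ₗ xs f + ∑ₗ xs g
  ∑ₗ-+ []       f g = refl
  ∑ₗ-+ (x ∷ xs) f g = trans (cong (f x + g x +_) (∑ₗ-+ xs f g)) (+-interchange (f x) (g x) _ _)

  ∑ₗ-*ˡ : (xs : List A) → ∀ c (f : A → ℕ) → ∑ₗ xs (λ x → c * f x) ≡ c * ∑ₗ xs f
  ∑ₗ-*ˡ []       c f = sym (*-zeroʳ c)
  ∑ₗ-*ˡ (x ∷ xs) c f = trans (cong (c * f x +_) (∑ₗ-*ˡ xs c f)) (sym (*-distribˡ-+ c (f x) _))

  ∑ₗ-∑-comm : (xs : List A) → ∀ n (f : A → ℕ → ℕ) → ∑ₗ xs (λ x → ∑ n (f x)) ≡ ∑ n (λ i → ∑ₗ xs (λ x → f x i))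
  ∑ₗ-∑-comm []       n f = sym (∑-zero n)
  ∑ₗ-∑-comm (x ∷ xs) n f = trans (cong (∑ n (f x) +_) (∑ₗ-∑-comm xs n f)) (sym (∑-+ n _ _))

  ∑ₗ-++ : (xs ys : List A) (f : A → ℕ) → ∑ₗ (xs ++ ys) f ≡ ∑ₗ xs f + ∑ₗ ys f
  ∑ₗ-++ []       ys f = refl
  ∑ₗ-++ (x ∷ xs) ys f = trans (cong (f x +_) (∑ₗ-++ xs ys f)) (sym (+-assoc (f x) _ _))

  sum-map : (xs : List A) (f : A → ℕ) → sum (map f xs) ≡ ∑ₗ xs f
  sum-map []       f = refl
  sum-map (x ∷ xs) f = cong (f x +_) (sum-map xs f)

  sum-concatMap : (h : A → List ℕ) (xs : List A) → sum (concatMap h xs) ≡ ∑ₗ xs (sum ∘ h)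
  sum-concatMap h []       = refl
  sum-concatMap h (x ∷ xs) = trans (sum-++ (h x) _) (cong (sum (h x) +_) (sum-concatMap h xs))

module _ {A B : Set} where

  ∑ₗ-comm : (xs : List A) (ys : List B) (f : A → B → ℕ) →
    ∑ₗ xs (λ x → ∑ₗ ys (f x)) ≡ ∑ₗ ys (λ y → ∑ₗ xs (λ x → f x y))
  ∑ₗ-comm []       ys f = sym (∑ₗ-zero ys)
  ∑ₗ-comm (x ∷ xs) ys f = trans (cong (∑ₗ ys (f x) +_) (∑ₗ-comm xs ys f)) (sym (∑ₗ-+ ys _ _))

  ∑ₗ-map : (xs : List A) (h : A → B) (f : B → ℕ) → ∑ₗ (map h xs) f ≡ ∑ₗ xs (f ∘ h)
  ∑ₗ-map []       h f = refl
  ∑ₗ-map (x ∷ xs) h f = cong (f (h x) +_) (∑ₗ-map xs h f)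

  ∑ₗ-concatMap : (xs : List A) (h : A → List B) (f : B → ℕ) → ∑ₗ (concatMap h xs) f ≡ ∑ₗ xs (λ x → ∑ₗ (h x) f)
  ∑ₗ-concatMap []       h f = refl
  ∑ₗ-concatMap (x ∷ xs) h f = trans (∑ₗ-++ (h x) _ f) (cong (∑ₗ (h x) f +_) (∑ₗ-concatMap xs h f))

∑ₗ-allFin : ∀ n (g : ℕ → ℕ) → ∑ₗ (allFin n) (g ∘ toℕ) ≡ ∑ n g
∑ₗ-allFin zero    g = refl
∑ₗ-allFin (suc n) g = cong (g 0 +_) (begin
    ∑ₗ (tabulate (Fin.suc {n})) (g ∘ toℕ)       ≡⟨ cong (λ xs → ∑ₗ xs (g ∘ toℕ)) (map-tabulate {n = n} (λ i → i) (Fin.suc {n})) ⟨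
    ∑ₗ (map (Fin.suc {n}) (allFin n)) (g ∘ toℕ) ≡⟨ ∑ₗ-map (allFin n) (Fin.suc {n}) (g ∘ toℕ) ⟩
    ∑ₗ (allFin n) (g ∘ suc ∘ toℕ)               ≡⟨ ∑ₗ-allFin n (g ∘ suc) ⟩
    ∑ n (g ∘ suc)                               ∎)
  where open ≡-Reasoning

∑pairs : (m k : ℕ) → (Vec (Fin k) m → Vec (Fin k) m → ℕ) → ℕ
∑pairs m k f = ∑ₗ (grid m k) (λ p → ∑ₗ (grid m k) (f p))

module _ (m k : ℕ) where

  ∑pairs-cong : {f g : Vec (Fin k) m → Vec (Fin k) m → ℕ} → (∀ p q → f p q ≡ g p q) → ∑pairs m k f ≡ ∑pairs m k g
  ∑pairs-cong eq = ∑ₗ-cong (grid m k) (λ p → ∑ₗ-cong (grid m k) (eq p))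

  ∑pairs-*ˡ : ∀ c f → ∑pairs m k (λ p q → c * f p q) ≡ c * ∑pairs m k f
  ∑pairs-*ˡ c f = trans (∑ₗ-cong (grid m k) (λ p → ∑ₗ-*ˡ (grid m k) c (f p))) (∑ₗ-*ˡ (grid m k) c _)

  ∑pairs-*ʳ : ∀ c f → ∑pairs m k (λ p q → f p q * c) ≡ ∑pairs m k f * c
  ∑pairs-*ʳ c f = trans (∑pairs-cong (λ p q → *-comm (f p q) c)) (trans (∑pairs-*ˡ c f) (*-comm c _))

  ∑pairs-∑-comm : ∀ n (f : Vec (Fin k) m → Vec (Fin k) m → ℕ → ℕ) →
    ∑pairs m k (λ p q → ∑ n (f p q)) ≡ ∑ n (λ i → ∑pairs m k (λ p q → f p q i))
  ∑pairs-∑-comm n f = trans (∑ₗ-cong (grid m k) (λ p → ∑ₗ-∑-comm (grid m k) n (f p))) (∑ₗ-∑-comm (grid m k) n _)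

  ∑pairs-∑ₗ-comm : {A : Set} (xs : List A) (f : Vec (Fin k) m → Vec (Fin k) m → A → ℕ) →
    ∑pairs m k (λ p q → ∑ₗ xs (f p q)) ≡ ∑ₗ xs (λ x → ∑pairs m k (λ p q → f p q x))
  ∑pairs-∑ₗ-comm xs f = trans (∑ₗ-cong (grid m k) (λ p → ∑ₗ-comm (grid m k) xs (f p))) (∑ₗ-comm (grid m k) xs _)

∑ₗ-allFin-≤ : ∀ k c {f : Fin k → ℕ} → (∀ i → f i ≤ c) → ∑ₗ (allFin k) f ≤ k * c
∑ₗ-allFin-≤ k c le = ≤-trans (∑ₗ-mono (allFin k) le) (≤-reflexive (trans (∑ₗ-allFin k (λ _ → c)) (∑-const k c)))

∑ₗ-grid-suc : ∀ m k (f : Vec (Fin k) (suc m) → ℕ) →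
  ∑ₗ (grid (suc m) k) f ≡ ∑ₗ (allFin k) (λ i → ∑ₗ (grid m k) (f ∘ (i ∷_)))
∑ₗ-grid-suc m k f = trans (∑ₗ-concatMap (allFin k) _ f) (∑ₗ-cong (allFin k) (λ i → ∑ₗ-map (grid m k) (i ∷_) f))

∑ₗ-grid-const : ∀ m k c → ∑ₗ (grid m k) (λ _ → c) ≡ k ^ m * c
∑ₗ-grid-const zero    k c = refl
∑ₗ-grid-const (suc m) k c = begin
    ∑ₗ (grid (suc m) k) (λ _ → c)                   ≡⟨ ∑ₗ-grid-suc m k _ ⟩
    ∑ₗ (allFin k) (λ _ → ∑ₗ (grid m k) (λ _ → c))  ≡⟨ ∑ₗ-cong (allFin k) (λ _ → ∑ₗ-grid-const m k c) ⟩
    ∑ₗ (allFin k) (λ _ → k ^ m * c)                ≡⟨ ∑ₗ-allFin k (λ _ → k ^ m * c) ⟩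
    ∑ k (λ _ → k ^ m * c)                           ≡⟨ ∑-const k _ ⟩
    k * (k ^ m * c)                                 ≡⟨ *-assoc k _ c ⟨
    k ^ suc m * c                                   ∎
  where open ≡-Reasoning

∑pairs-suc : ∀ m k f → ∑pairs (suc m) k f ≡
  ∑ₗ (allFin k) (λ i → ∑ₗ (allFin k) (λ j → ∑pairs m k (λ p q → f (i ∷ p) (j ∷ q))))
∑pairs-suc m k f = begin
    ∑pairs (suc m) k f
      ≡⟨ ∑ₗ-grid-suc m k _ ⟩
    ∑ₗ Fk (λ i → ∑ₗ G (λ p → ∑ₗ (grid (suc m) k) (f (i ∷ p))))
      ≡⟨ ∑ₗ-cong Fk (λ i → ∑ₗ-cong G (λ p → ∑ₗ-grid-suc m k _)) ⟩
    ∑ₗ Fk (λ i → ∑ₗ G (λ p → ∑ₗ Fk (λ j → ∑ₗ G (λ q → f (i ∷ p) (j ∷ q)))))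
      ≡⟨ ∑ₗ-cong Fk (λ i → ∑ₗ-comm G Fk _) ⟩
    ∑ₗ Fk (λ i → ∑ₗ Fk (λ j → ∑pairs m k (λ p q → f (i ∷ p) (j ∷ q)))) ∎
  where
  open ≡-Reasoning
  Fk = allFin k
  G  = grid m k

coordSq : {k : ℕ} → Fin k → Fin k → ℕ
coordSq i j = ∣ coord i - coord j ∣ * ∣ coord i - coord j ∣

-- The shifts A, B make the count recursive in the dimension.
shiftedE2 : (m k A B : ℕ) → ℕ
shiftedE2 m k A B = ∑pairs m k λ p₁ q₁ → ∑pairs m k λ p₂ q₂ → 𝟙 (A + sqDist p₁ q₁ ≟ B + sqDist p₂ q₂)

E2≡shiftedE2 : ∀ m k → E2 m k ≡ shiftedE2 m k 0 0
E2≡shiftedE2 m k = trans (sum-concatMap _ P) (∑ₗ-cong P λ p₁ → trans (sum-concatMap _ P) (∑ₗ-cong P λ q₁ →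
                     trans (sum-concatMap _ P) (∑ₗ-cong P λ p₂ → sum-map P _)))
  where P = grid m k

shiftedE2-suc : ∀ m k A B → shiftedE2 (suc m) k A B ≡
  ∑ₗ (allFin k) λ i₁ → ∑ₗ (allFin k) λ j₁ → ∑ₗ (allFin k) λ i₂ → ∑ₗ (allFin k) λ j₂ →
    shiftedE2 m k (A + coordSq i₁ j₁) (B + coordSq i₂ j₂)
shiftedE2-suc m k A B = begin
    shiftedE2 (suc m) k A B
      ≡⟨ ∑pairs-suc m k _ ⟩
    ∑ₗ Fk (λ i₁ → ∑ₗ Fk λ j₁ → ∑pairs m k λ p₁ q₁ → ∑pairs (suc m) k λ p₂ q₂ → δ (i₁ ∷ p₁) (j₁ ∷ q₁) p₂ q₂)
      ≡⟨ ∑ₗ-cong Fk (λ i₁ → ∑ₗ-cong Fk λ j₁ → ∑pairs-cong m k λ p₁ q₁ → ∑pairs-suc m k _) ⟩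
    ∑ₗ Fk (λ i₁ → ∑ₗ Fk λ j₁ → ∑pairs m k λ p₁ q₁ → ∑ₗ Fk λ i₂ → ∑ₗ Fk λ j₂ →
                                   ∑pairs m k λ p₂ q₂ → δ (i₁ ∷ p₁) (j₁ ∷ q₁) (i₂ ∷ p₂) (j₂ ∷ q₂))
      ≡⟨ ∑ₗ-cong Fk (λ i₁ → ∑ₗ-cong Fk λ j₁ → trans (∑pairs-∑ₗ-comm m k Fk _)
                                                   (∑ₗ-cong Fk λ i₂ → ∑pairs-∑ₗ-comm m k Fk _)) ⟩
    ∑ₗ Fk (λ i₁ → ∑ₗ Fk λ j₁ → ∑ₗ Fk λ i₂ → ∑ₗ Fk λ j₂ → ∑pairs m k λ p₁ q₁ →
                                   ∑pairs m k λ p₂ q₂ → δ (i₁ ∷ p₁) (j₁ ∷ q₁) (i₂ ∷ p₂) (j₂ ∷ q₂))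
      ≡⟨ ∑ₗ-cong Fk (λ i₁ → ∑ₗ-cong Fk λ j₁ → ∑ₗ-cong Fk λ i₂ → ∑ₗ-cong Fk λ j₂ →
           ∑pairs-cong m k λ p₁ q₁ → ∑pairs-cong m k λ p₂ q₂ →
             cong₂ (λ x y → 𝟙 (x ≟ y)) (sym (+-assoc A _ _)) (sym (+-assoc B _ _))) ⟩
    _ ∎
  where
  open ≡-Reasoning
  Fk = allFin k
  δ : ∀ {n} (p₁ q₁ p₂ q₂ : Vec (Fin k) n) → ℕ
  δ p₁ q₁ p₂ q₂ = 𝟙 (A + sqDist p₁ q₁ ≟ B + sqDist p₂ q₂)

shiftedE2-suc-≤ : ∀ m k U → (∀ A B → shiftedE2 m k A B ≤ U) → ∀ A B → shiftedE2 (suc m) k A B ≤ k ^ 4 * U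
shiftedE2-suc-≤ m k U bound A B = begin
    shiftedE2 (suc m) k A B ≡⟨ shiftedE2-suc m k A B ⟩
    _                       ≤⟨ ∑ₗ-allFin-≤ k _ (λ i₁ → ∑ₗ-allFin-≤ k _ λ j₁ → ∑ₗ-allFin-≤ k _ λ i₂ → ∑ₗ-allFin-≤ k _ λ j₂ →
                                 bound (A + coordSq i₁ j₁) (B + coordSq i₂ j₂)) ⟩
    k * (k * (k * (k * U))) ≡⟨ k⁴ k U ⟩
    k ^ 4 * U               ∎
  where
  open ≤-Reasoning
  k⁴ : ∀ k U → k * (k * (k * (k * U))) ≡ k * (k * (k * (k * 1))) * U
  k⁴ = solve-∀

-- The lower bound

sqDist≤ : ∀ {m k} (p q : Vec (Fin k) m) → sqDist p q ≤ m * (k * k)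
sqDist≤ []      []      = z≤n
sqDist≤ (x ∷ p) (y ∷ q) = +-mono-≤ (*-mono-≤ coordDiff≤ coordDiff≤) (sqDist≤ p q)
  where coordDiff≤ = ≤-trans (∣m-n∣≤m⊔n (coord x) (coord y)) (⊔-lub (toℕ<n x) (toℕ<n y))

∑-Cauchy–Schwarz : ∀ R (f : ℕ → ℕ) → ∑ R f * ∑ R f ≤ R * ∑ R (λ r → f r * f r)
∑-Cauchy–Schwarz R f = *-cancelˡ-≤ 2 (begin
    2 * (∑ R f * ∑ R f)                                  ≡⟨ cong (2 *_) square-expand ⟩
    2 * ∑ R (λ i → ∑ R (λ j → f i * f j))                ≡⟨ double-*ˡ ⟨
    ∑ R (λ i → ∑ R (λ j → 2 * (f i * f j)))              ≤⟨ ∑-mono R (λ i → ∑-mono R λ j →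
                                                              ≤-trans (≤-reflexive (sym (*-assoc 2 (f i) (f j)))) (2mn≤m²+n² (f i) (f j))) ⟩
    ∑ R (λ i → ∑ R (λ j → f i * f i + f j * f j))        ≡⟨ ∑-cong R (λ i → trans (∑-+ R _ _) (cong (_+ Q) (∑-const R _))) ⟩
    ∑ R (λ i → R * (f i * f i) + Q)                      ≡⟨ trans (∑-+ R _ _) (cong₂ _+_ (∑-*ˡ R R _) (∑-const R Q)) ⟩
    R * Q + R * Q                                        ≡⟨ cong (R * Q +_) (+-identityʳ (R * Q)) ⟨
    2 * (R * Q)                                          ∎)
  where
  open ≤-Reasoning
  Q = ∑ R (λ r → f r * f r)
  square-expand : ∑ R f * ∑ R f ≡ ∑ R (λ i → ∑ R (λ j → f i * f j))
  square-expand = trans (sym (∑-*ʳ R _ f)) (∑-cong R λ i → sym (∑-*ˡ R (f i) f))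
  double-*ˡ : ∑ R (λ i → ∑ R (λ j → 2 * (f i * f j))) ≡ 2 * ∑ R (λ i → ∑ R (λ j → f i * f j))
  double-*ˡ = trans (∑-cong R λ i → ∑-*ˡ R 2 _) (∑-*ˡ R 2 _)

distanceCount : (m k r : ℕ) → ℕ
distanceCount m k r = ∑pairs m k (λ p q → 𝟙 (sqDist p q ≟ r))

module _ (m k R : ℕ) (sqDist<R : (p q : Vec (Fin k) m) → sqDist p q < R) where

  ∑-distanceCount : ∑ R (distanceCount m k) ≡ k ^ m * k ^ m
  ∑-distanceCount = begin
      ∑ R (distanceCount m k)                        ≡⟨ ∑pairs-∑-comm m k R _ ⟨
      ∑pairs m k (λ p q → ∑ R (λ r → 𝟙 (sqDist p q ≟ r)))
        ≡⟨ ∑pairs-cong m k (λ p q → trans (∑-cong R λ r → sym (*-identityʳ _)) (∑-𝟙≡ R _ (λ _ → 1) (sqDist<R p q))) ⟩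
      ∑pairs m k (λ _ _ → 1)                          ≡⟨ ∑ₗ-cong (grid m k) (λ _ → trans (∑ₗ-grid-const m k 1) (*-identityʳ _)) ⟩
      ∑ₗ (grid m k) (λ _ → k ^ m)                    ≡⟨ ∑ₗ-grid-const m k (k ^ m) ⟩
      k ^ m * k ^ m                                  ∎
    where open ≡-Reasoning

  E2≡∑-distanceCount² : E2 m k ≡ ∑ R (λ r → distanceCount m k r * distanceCount m k r)
  E2≡∑-distanceCount² = begin
      E2 m k
        ≡⟨ E2≡shiftedE2 m k ⟩
      ∑pairs m k (λ p₁ q₁ → ∑pairs m k λ p₂ q₂ → 𝟙 (sqDist p₁ q₁ ≟ sqDist p₂ q₂))
        ≡⟨ ∑pairs-cong m k (λ p₁ q₁ → ∑pairs-cong m k λ p₂ q₂ →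
             trans (𝟙-cong (sqDist p₁ q₁ ≟ sqDist p₂ q₂) (sqDist p₂ q₂ ≟ sqDist p₁ q₁) sym sym) (sym (∑-𝟙≡ R _ _ (sqDist<R p₁ q₁)))) ⟩
      ∑pairs m k (λ p₁ q₁ → ∑pairs m k λ p₂ q₂ → ∑ R λ r → 𝟙 (sqDist p₁ q₁ ≟ r) * 𝟙 (sqDist p₂ q₂ ≟ r))
        ≡⟨ ∑pairs-cong m k (λ p₁ q₁ → ∑pairs-∑-comm m k R _) ⟩
      ∑pairs m k (λ p₁ q₁ → ∑ R λ r → ∑pairs m k λ p₂ q₂ → 𝟙 (sqDist p₁ q₁ ≟ r) * 𝟙 (sqDist p₂ q₂ ≟ r))
        ≡⟨ ∑pairs-∑-comm m k R _ ⟩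
      ∑ R (λ r → ∑pairs m k λ p₁ q₁ → ∑pairs m k λ p₂ q₂ → 𝟙 (sqDist p₁ q₁ ≟ r) * 𝟙 (sqDist p₂ q₂ ≟ r))
        ≡⟨ ∑-cong R (λ r → trans (∑pairs-cong m k λ p₁ q₁ → ∑pairs-*ˡ m k (𝟙 (sqDist p₁ q₁ ≟ r)) _) (∑pairs-*ʳ m k (distanceCount m k r) _)) ⟩
      ∑ R (λ r → distanceCount m k r * distanceCount m k r) ∎
    where open ≡-Reasoning

  energy-lower-bound : (k ^ m * k ^ m) * (k ^ m * k ^ m) ≤ R * E2 m k
  energy-lower-bound = begin
      (k ^ m * k ^ m) * (k ^ m * k ^ m)                   ≡⟨ cong (λ x → x * x) ∑-distanceCount ⟨
      ∑ R (distanceCount m k) * ∑ R (distanceCount m k)   ≤⟨ ∑-Cauchy–Schwarz R _ ⟩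
      R * ∑ R (λ r → distanceCount m k r * distanceCount m k r) ≡⟨ cong (R *_) E2≡∑-distanceCount² ⟨
      R * E2 m k                                          ∎
    where open ≤-Reasoning

-- Spaced supports and lattice points on a plane

Spaced : (s n : ℕ) → (ℕ → ℕ) → Set
Spaced s n f = ∀ {t t'} → t ≤ t' → t' < n → 1 ≤ f t → 1 ≤ f t' → s ∣ t' ∸ t

Indicator : (ℕ → ℕ) → Set
Indicator f = ∀ t → f t ≤ 1

Spaced-shift : ∀ {s n f} a → Spaced s (a + n) f → Spaced s n (λ t → f (a + t))
Spaced-shift {s} a spaced {t} {t'} t≤t' t'<n ft ft' =
  subst (s ∣_) ([m+n]∸[m+o]≡n∸o a t' t) (spaced (+-monoʳ-≤ a t≤t') (+-monoʳ-< a t'<n) ft ft')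

module _ (s : ℕ) .{{_ : NonZero s}} where

  -- A support point at 0 forces f to vanish on 1, …, s - 1.
  ∑-initial-segment : ∀ {n f} → Indicator f → Spaced s n f → f 0 ≡ 1 →
    ∀ l → 1 ≤ l → l ≤ s → l ≤ n → ∑ l f ≡ 1
  ∑-initial-segment {n} {f} ind spaced f0≡1 (suc l) _ l<s l<n = begin
      f 0 + ∑ l (f ∘ suc) ≡⟨ cong₂ _+_ f0≡1 (∑-cong-< l vanish) ⟩
      1 + ∑ l (λ _ → 0)   ≡⟨ cong suc (∑-zero l) ⟩
      1                   ∎
    where
    open ≡-Reasoning
    vanish : ∀ t → t < l → f (suc t) ≡ 0
    vanish t t<l with f (suc t) in eq
    ... | zero  = refl
    ... | suc _ = ⊥-elim (<⇒≱ (≤-trans (s<s t<l) l<s)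
                    (∣⇒≤ (spaced z≤n (≤-trans (s<s t<l) l<n) (≤-reflexive (sym f0≡1)) (subst (1 ≤_) (sym eq) (s≤s z≤n)))))

  spaced-∑-bound : ∀ n f → Indicator f → Spaced s n f → s * ∑ n f ≤ n + s
  spaced-∑-bound = <-rec (λ n → ∀ f → Indicator f → Spaced s n f → s * ∑ n f ≤ n + s) step
    where
    step : ∀ n → (∀ {r} → r < n → ∀ f → Indicator f → Spaced s r f → s * ∑ r f ≤ r + s) →
           ∀ f → Indicator f → Spaced s n f → s * ∑ n f ≤ n + s
    step zero    rec f ind spaced = ≤-trans (≤-reflexive (*-zeroʳ s)) z≤n
    step (suc n) rec f ind spaced with ≤1-cases (ind 0) | ≤-total (suc n) s
    ... | inj₁ f0 | _ = begin
        s * ∑ (suc n) f   ≡⟨ cong (λ x → s * (x + ∑ n (f ∘ suc))) f0 ⟩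
        s * ∑ n (f ∘ suc) ≤⟨ rec (n<1+n n) (f ∘ suc) (ind ∘ suc) (Spaced-shift 1 spaced) ⟩
        n + s             ≤⟨ +-monoˡ-≤ s (n≤1+n n) ⟩
        suc n + s         ∎
      where open ≤-Reasoning
    ... | inj₂ f0 | inj₁ n<s = begin
        s * ∑ (suc n) f ≡⟨ cong (s *_) (∑-initial-segment ind spaced f0 (suc n) (s≤s z≤n) n<s ≤-refl) ⟩
        s * 1           ≡⟨ *-identityʳ s ⟩
        s               ≤⟨ m≤n+m s (suc n) ⟩
        suc n + s       ∎
      where open ≤-Reasoning
    ... | inj₂ f0 | inj₂ s≤n = begin
        s * ∑ (suc n) f                 ≡⟨ cong (λ l → s * ∑ l f) (m+[n∸m]≡n s≤n) ⟨
        s * ∑ (s + r) f                 ≡⟨ cong (s *_) (∑-split s r f) ⟩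
        s * (∑ s f + ∑ r g)             ≡⟨ cong (λ x → s * (x + ∑ r g)) (∑-initial-segment ind spaced f0 s (>-nonZero⁻¹ s) ≤-refl s≤n) ⟩
        s * (1 + ∑ r g)                 ≡⟨ *-distribˡ-+ s 1 (∑ r g) ⟩
        s * 1 + s * ∑ r g               ≤⟨ +-mono-≤ (≤-reflexive (*-identityʳ s)) (rec r<n g (ind ∘ (s +_)) (Spaced-shift s spaced′)) ⟩
        s + (r + s)                     ≡⟨ +-assoc s r s ⟨
        s + r + s                       ≡⟨ cong (_+ s) (m+[n∸m]≡n s≤n) ⟩
        suc n + s                       ∎
      where
      open ≤-Reasoning
      r = suc n ∸ s
      g = λ t → f (s + t)
      r<n : r < suc n
      r<n = ∸-monoʳ-< (>-nonZero⁻¹ s) s≤n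
      spaced′ : Spaced s (s + r) f
      spaced′ = subst (λ l → Spaced s l f) (sym (m+[n∸m]≡n s≤n)) spaced

∑≤1-of-unique : ∀ n f → Indicator f →
  (∀ {t t'} → t ≤ t' → t' < n → 1 ≤ f t → 1 ≤ f t' → t ≡ t') → ∑ n f ≤ 1
∑≤1-of-unique n f ind unique = m<1+n⇒m≤n (*-cancelˡ-< (suc n) (∑ n f) 2 (begin-strict
    suc n * ∑ n f ≤⟨ spaced-∑-bound (suc n) n f ind spaced ⟩
    n + suc n     <⟨ +-monoˡ-< (suc n) (n<1+n n) ⟩
    suc n + suc n ≡⟨ trans (*-suc (suc n) 1) (cong (suc n +_) (*-identityʳ (suc n))) ⟨
    suc n * 2     ∎))
  where
  open ≤-Reasoning
  spaced : Spaced (suc n) n f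
  spaced {t} {t'} t≤t' t'<n ft ft' =
    subst (λ u → suc n ∣ t' ∸ u) (sym (unique t≤t' t'<n ft ft')) (subst (suc n ∣_) (sym (n∸n≡0 t')) (suc n ∣0))

linearCount : (n c x₁ x₂ x₃ : ℕ) → ℕ
linearCount n c x₁ x₂ x₃ = ∑ n λ a₁ → ∑ n λ a₂ → ∑ n λ a₃ → 𝟙 (x₁ * a₁ + x₂ * a₂ + x₃ * a₃ ≟ c)

module LinearCount (n c x₁ x₂ x₃ : ℕ) .{{_ : NonZero x₃}} where

  L : ℕ → ℕ → ℕ → ℕ
  L a₁ a₂ a₃ = x₁ * a₁ + x₂ * a₂ + x₃ * a₃

  solution : ℕ → ℕ → ℕ → ℕ
  solution a₁ a₂ a₃ = 𝟙 (L a₁ a₂ a₃ ≟ c)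

  solutions₂ : ℕ → ℕ → ℕ
  solutions₂ a₁ a₂ = ∑ n (solution a₁ a₂)

  solutions₁ : ℕ → ℕ
  solutions₁ a₁ = ∑ n (solutions₂ a₁)

  hasSolution : ℕ → ℕ
  hasSolution a₁ = 𝟙 (1 ≤? solutions₁ a₁)

  h g s₁ s₂ : ℕ
  h = gcd x₂ x₃
  g = gcd x₁ h
  instance
    h≢0 : NonZero h
    h≢0 = gcd≢0ʳ x₂ x₃
    g≢0 : NonZero g
    g≢0 = gcd≢0ʳ x₁ h
  s₂ = x₃ / h
  s₁ = h / g

  same-L : ∀ {a₁ a₂ a₃ b₁ b₂ b₃} → 1 ≤ solution a₁ a₂ a₃ → 1 ≤ solution b₁ b₂ b₃ → L a₁ a₂ a₃ ≡ L b₁ b₂ b₃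
  same-L sa sb = trans (𝟙-witness (_ ≟ c) sa) (sym (𝟙-witness (_ ≟ c) sb))

  L-assoc : ∀ a₁ a₂ a₃ → L a₁ a₂ a₃ ≡ x₁ * a₁ + (x₂ * a₂ + x₃ * a₃)
  L-assoc a₁ a₂ a₃ = +-assoc (x₁ * a₁) (x₂ * a₂) (x₃ * a₃)

  same-L′ : ∀ {a₁ a₂ a₃ b₁ b₂ b₃} → 1 ≤ solution a₁ a₂ a₃ → 1 ≤ solution b₁ b₂ b₃ →
    x₁ * a₁ + (x₂ * a₂ + x₃ * a₃) ≡ x₁ * b₁ + (x₂ * b₂ + x₃ * b₃)
  same-L′ {a₁} {a₂} {a₃} {b₁} {b₂} {b₃} sa sb = trans (sym (L-assoc a₁ a₂ a₃)) (trans (same-L sa sb) (L-assoc b₁ b₂ b₃))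

  solutions₂≤1 : ∀ a₁ a₂ → solutions₂ a₁ a₂ ≤ 1
  solutions₂≤1 a₁ a₂ = ∑≤1-of-unique n (solution a₁ a₂) (λ a₃ → 𝟙≤1 (L a₁ a₂ a₃ ≟ c))
    (λ {a₃} {a₃'} _ _ sa sb → *-cancelˡ-≡ a₃ a₃' x₃ (+-cancelˡ-≡ (x₁ * a₁ + x₂ * a₂) _ _ (same-L sa sb)))

  solutions₂-spaced : ∀ a₁ → Spaced s₂ n (solutions₂ a₁)
  solutions₂-spaced a₁ {a₂} {a₂'} a₂≤a₂' _ sa sb with ∑-pos n _ sa | ∑-pos n _ sb
  ... | a₃ , sa₃ | a₃' , sb₃ = n∣m*o⇒n/gcd[m,n]∣o x₂ x₃ _
    (∣-of-equal-sums {m = x₂} a₂≤a₂' (+-cancelˡ-≡ (x₁ * a₁) _ _ (same-L′ sa₃ sb₃)) (m∣m*n a₃) (m∣m*n a₃'))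

  hasSolution-spaced : Spaced s₁ n hasSolution
  hasSolution-spaced {a₁} {a₁'} a₁≤a₁' _ sa sb with ∑-pos n _ (𝟙-witness (1 ≤? _) sa) | ∑-pos n _ (𝟙-witness (1 ≤? _) sb)
  ... | a₂ , sa₂ | a₂' , sb₂ with ∑-pos n _ sa₂ | ∑-pos n _ sb₂
  ...   | a₃ , sa₃ | a₃' , sb₃ = n∣m*o⇒n/gcd[m,n]∣o x₁ h _
    (∣-of-equal-sums {m = x₁} a₁≤a₁' (same-L′ sa₃ sb₃) (h∣ a₂ a₃) (h∣ a₂' a₃'))
    where h∣ : ∀ a₂ a₃ → h ∣ x₂ * a₂ + x₃ * a₃
          h∣ a₂ a₃ = ∣m∣n⇒∣m+n (∣m⇒∣m*n a₂ (gcd[m,n]∣m x₂ x₃)) (∣m⇒∣m*n a₃ (gcd[m,n]∣n x₂ x₃))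

  instance
    s₂≢0 : NonZero s₂
    s₂≢0 = >-nonZero (m≥n⇒m/n>0 (gcd[m,n]≤n x₂ x₃))
    s₁≢0 : NonZero s₁
    s₁≢0 = >-nonZero (m≥n⇒m/n>0 (gcd[m,n]≤n x₁ h))

  s₂*solutions₁≤ : ∀ a₁ → s₂ * solutions₁ a₁ ≤ (n + s₂) * hasSolution a₁
  s₂*solutions₁≤ a₁ with 1 ≤? solutions₁ a₁
  ... | yes some = begin
      s₂ * solutions₁ a₁             ≤⟨ spaced-∑-bound s₂ n _ (solutions₂≤1 a₁) (solutions₂-spaced a₁) ⟩
      n + s₂                         ≡⟨ *-identityʳ (n + s₂) ⟨
      (n + s₂) * 1                   ≡⟨ cong ((n + s₂) *_) (𝟙-yes (1 ≤? solutions₁ a₁) some) ⟨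
      (n + s₂) * hasSolution a₁      ∎
    where open ≤-Reasoning
  ... | no none = begin
      s₂ * solutions₁ a₁             ≡⟨ cong (s₂ *_) (n<1⇒n≡0 (≰⇒> none)) ⟩
      s₂ * 0                         ≡⟨ *-zeroʳ s₂ ⟩
      0                              ≤⟨ z≤n ⟩
      (n + s₂) * hasSolution a₁      ∎
    where open ≤-Reasoning

  s₁*s₂*g≡x₃ : s₁ * s₂ * g ≡ x₃
  s₁*s₂*g≡x₃ = begin
      s₁ * s₂ * g   ≡⟨ *-right-comm s₁ s₂ g ⟩
      s₁ * g * s₂   ≡⟨ cong (_* s₂) (m/n*n≡m (gcd[m,n]∣n x₁ h)) ⟩
      h * s₂        ≡⟨ *-comm h s₂ ⟩
      s₂ * h        ≡⟨ m/n*n≡m (gcd[m,n]∣n x₂ x₃) ⟩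
      x₃            ∎
    where open ≡-Reasoning

  count*s₁s₂≤ : linearCount n c x₁ x₂ x₃ * (s₁ * s₂) ≤ (n + s₂) * (n + s₁)
  count*s₁s₂≤ = begin
      C * (s₁ * s₂)                             ≡⟨ x∙yz≈y∙zx C s₁ s₂ ⟩
      s₁ * (s₂ * C)                             ≡⟨ cong (s₁ *_) (∑-*ˡ n s₂ solutions₁) ⟨
      s₁ * ∑ n (λ a₁ → s₂ * solutions₁ a₁)       ≤⟨ *-monoʳ-≤ s₁ (∑-mono n s₂*solutions₁≤) ⟩
      s₁ * ∑ n (λ a₁ → (n + s₂) * hasSolution a₁) ≡⟨ cong (s₁ *_) (∑-*ˡ n (n + s₂) hasSolution) ⟩
      s₁ * ((n + s₂) * ∑ n hasSolution)         ≡⟨ x∙yz≈y∙xz s₁ (n + s₂) _ ⟩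
      (n + s₂) * (s₁ * ∑ n hasSolution)         ≤⟨ *-monoʳ-≤ (n + s₂) (spaced-∑-bound s₁ n hasSolution
                                                      (λ a₁ → 𝟙≤1 (1 ≤? solutions₁ a₁)) hasSolution-spaced) ⟩
      (n + s₂) * (n + s₁)                       ∎
    where
    open ≤-Reasoning
    C = linearCount n c x₁ x₂ x₃

linearCount-bound : ∀ n c x₁ x₂ x₃ .{{_ : NonZero x₃}} →
  linearCount n c x₁ x₂ x₃ * x₃ ≤ n * n * gcd x₁ (gcd x₂ x₃) + (2 * n + 1) * x₃
linearCount-bound n c x₁ x₂ x₃ = begin
    C * x₃                              ≡⟨ cong (C *_) s₁*s₂*g≡x₃ ⟨
    C * (s₁ * s₂ * g)                   ≡⟨ *-assoc C (s₁ * s₂) g ⟨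
    C * (s₁ * s₂) * g                   ≤⟨ *-monoˡ-≤ g (≤-trans count*s₁s₂≤ ([n+b][n+a]≤n²+[2n+1]ab n s₁ s₂ (>-nonZero⁻¹ s₁) (>-nonZero⁻¹ s₂))) ⟩
    (n * n + (2 * n + 1) * (s₁ * s₂)) * g ≡⟨ *-distribʳ-+ g (n * n) _ ⟩
    n * n * g + (2 * n + 1) * (s₁ * s₂) * g ≡⟨ cong (n * n * g +_) (trans (*-assoc (2 * n + 1) _ g) (cong ((2 * n + 1) *_) s₁*s₂*g≡x₃)) ⟩
    n * n * g + (2 * n + 1) * x₃        ∎
  where
  open ≤-Reasoning
  open LinearCount n c x₁ x₂ x₃
  C = linearCount n c x₁ x₂ x₃

-- Dimension three: from the energy to plane counts

normPairs : (k m A B : ℕ) → ℕ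
normPairs k zero    A B = 𝟙 (A ≟ B)
normPairs k (suc m) A B = ∑ k λ a → ∑ k λ b → normPairs k m (A + a * a) (B + b * b)

∑-reverse : ∀ u (g : ℕ → ℕ) → ∑ u (λ v → g (u ∸ v)) ≡ ∑ u (g ∘ suc)
∑-reverse zero    g = refl
∑-reverse (suc u) g = begin
    g (suc u) + ∑ u (λ v → g (u ∸ v)) ≡⟨ cong (g (suc u) +_) (∑-reverse u g) ⟩
    g (suc u) + ∑ u (g ∘ suc)         ≡⟨ +-comm (g (suc u)) _ ⟩
    ∑ u (g ∘ suc) + g (suc u)         ≡⟨ cong (∑ u (g ∘ suc) +_) (trans (+-identityʳ _) (cong (g ∘ suc) (+-identityʳ u))) ⟨
    ∑ u (g ∘ suc) + ∑ 1 (λ i → g (suc (u + i))) ≡⟨ ∑-split u 1 (g ∘ suc) ⟨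
    ∑ (u + 1) (g ∘ suc)               ≡⟨ cong (λ l → ∑ l (g ∘ suc)) (+-comm u 1) ⟩
    ∑ (suc u) (g ∘ suc)               ∎
  where open ≡-Reasoning

∑-∣-∣ : ∀ k u (g : ℕ → ℕ) → u < k → ∑ k (λ v → g ∣ u - v ∣) ≤ 2 * ∑ k g
∑-∣-∣ k u g u<k = begin
    ∑ k (λ v → g ∣ u - v ∣)                                   ≡⟨ cong (λ l → ∑ l (λ v → g ∣ u - v ∣)) (m+[n∸m]≡n (<⇒≤ u<k)) ⟨
    ∑ (u + (k ∸ u)) (λ v → g ∣ u - v ∣)                       ≡⟨ ∑-split u (k ∸ u) _ ⟩
    ∑ u (λ v → g ∣ u - v ∣) + ∑ (k ∸ u) (λ i → g ∣ u - (u + i) ∣) ≡⟨ cong₂ _+_ below above ⟩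
    ∑ u (g ∘ suc) + ∑ (k ∸ u) g                              ≤⟨ +-mono-≤ (≤-trans (m≤n+m _ (g 0)) (∑-mono-length g u<k)) (∑-mono-length g (m∸n≤m k u)) ⟩
    ∑ k g + ∑ k g                                            ≡⟨ cong (∑ k g +_) (+-identityʳ _) ⟨
    2 * ∑ k g                                                ∎
  where
  open ≤-Reasoning
  below : ∑ u (λ v → g ∣ u - v ∣) ≡ ∑ u (g ∘ suc)
  below = trans (∑-cong-< u (λ v v<u → cong g (m≤n⇒∣n-m∣≡n∸m (<⇒≤ v<u)))) (∑-reverse u g)
  above : ∑ (k ∸ u) (λ i → g ∣ u - (u + i) ∣) ≡ ∑ (k ∸ u) g
  above = ∑-cong (k ∸ u) (λ i → cong g (trans (m≤n⇒∣m-n∣≡n∸m (m≤m+n u i)) (m+n∸m≡n u i)))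

∑-∣-∣² : ∀ k (g : ℕ → ℕ) → ∑ k (λ u → ∑ k (λ v → g ∣ u - v ∣)) ≤ 2 * k * ∑ k g
∑-∣-∣² k g = ≤-trans (∑-≤-const k _ (λ u u<k → ∑-∣-∣ k u g u<k)) (≤-reflexive (x∙yz≈yx∙z k 2 (∑ k g)))

∑ₗ-coordSq : ∀ k (Ψ : ℕ → ℕ) →
  ∑ₗ (allFin k) (λ i → ∑ₗ (allFin k) (λ j → Ψ (coordSq i j))) ≤ 2 * k * ∑ k (λ a → Ψ (a * a))
∑ₗ-coordSq k Ψ = begin
    ∑ₗ (allFin k) (λ i → ∑ₗ (allFin k) (λ j → Ψ (coordSq i j)))
      ≡⟨ ∑ₗ-cong (allFin k) (λ i → ∑ₗ-allFin k (λ v → Ψ (∣ toℕ i - v ∣ * ∣ toℕ i - v ∣))) ⟩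
    ∑ₗ (allFin k) (λ i → ∑ k (λ v → Ψ (∣ toℕ i - v ∣ * ∣ toℕ i - v ∣)))
      ≡⟨ ∑ₗ-allFin k (λ u → ∑ k (λ v → Ψ (∣ u - v ∣ * ∣ u - v ∣))) ⟩
    ∑ k (λ u → ∑ k (λ v → Ψ (∣ u - v ∣ * ∣ u - v ∣)))
      ≤⟨ ∑-∣-∣² k (λ a → Ψ (a * a)) ⟩
    2 * k * ∑ k (λ a → Ψ (a * a)) ∎
  where open ≤-Reasoning

∑ₗ-coordSq² : ∀ k (Φ : ℕ → ℕ → ℕ) →
  (∑ₗ (allFin k) λ i₁ → ∑ₗ (allFin k) λ j₁ → ∑ₗ (allFin k) λ i₂ → ∑ₗ (allFin k) λ j₂ → Φ (coordSq i₁ j₁) (coordSq i₂ j₂))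
    ≤ 2 * k * (2 * k * ∑ k (λ a → ∑ k (λ b → Φ (a * a) (b * b))))
∑ₗ-coordSq² k Φ = begin
    ∑ₗ Fk (λ i₁ → ∑ₗ Fk λ j₁ → ∑ₗ Fk λ i₂ → ∑ₗ Fk λ j₂ → Φ (coordSq i₁ j₁) (coordSq i₂ j₂))
      ≤⟨ ∑ₗ-mono Fk (λ i₁ → ∑ₗ-mono Fk λ j₁ → ∑ₗ-coordSq k (Φ (coordSq i₁ j₁))) ⟩
    ∑ₗ Fk (λ i₁ → ∑ₗ Fk λ j₁ → 2 * k * ∑ k (λ b → Φ (coordSq i₁ j₁) (b * b)))
      ≤⟨ ∑ₗ-coordSq k (λ c → 2 * k * ∑ k (λ b → Φ c (b * b))) ⟩
    2 * k * ∑ k (λ a → 2 * k * ∑ k (λ b → Φ (a * a) (b * b)))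
      ≡⟨ cong (2 * k *_) (∑-*ˡ k (2 * k) _) ⟩
    2 * k * (2 * k * ∑ k (λ a → ∑ k (λ b → Φ (a * a) (b * b)))) ∎
  where
  open ≤-Reasoning
  Fk = allFin k

shiftedE2≤normPairs : ∀ m k A B → shiftedE2 m k A B ≤ (2 * k) ^ (2 * m) * normPairs k m A B
shiftedE2≤normPairs zero    k A B = ≤-reflexive (begin
    𝟙 (A + 0 ≟ B + 0) + 0 + 0 + 0 + 0 ≡⟨ trans (+-identityʳ _) (trans (+-identityʳ _) (+-identityʳ _)) ⟩
    𝟙 (A + 0 ≟ B + 0) + 0             ≡⟨ cong (λ x → x + 0) (cong₂ (λ x y → 𝟙 (x ≟ y)) (+-identityʳ A) (+-identityʳ B)) ⟩
    𝟙 (A ≟ B) + 0                     ∎)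
  where open ≡-Reasoning
shiftedE2≤normPairs (suc m) k A B = begin
    shiftedE2 (suc m) k A B
      ≡⟨ shiftedE2-suc m k A B ⟩
    ∑ₗ Fk (λ i₁ → ∑ₗ Fk λ j₁ → ∑ₗ Fk λ i₂ → ∑ₗ Fk λ j₂ → shiftedE2 m k (A + coordSq i₁ j₁) (B + coordSq i₂ j₂))
      ≤⟨ ∑ₗ-mono Fk (λ i₁ → ∑ₗ-mono Fk λ j₁ → ∑ₗ-mono Fk λ i₂ → ∑ₗ-mono Fk λ j₂ →
           shiftedE2≤normPairs m k (A + coordSq i₁ j₁) (B + coordSq i₂ j₂)) ⟩
    ∑ₗ Fk (λ i₁ → ∑ₗ Fk λ j₁ → ∑ₗ Fk λ i₂ → ∑ₗ Fk λ j₂ → c * normPairs k m (A + coordSq i₁ j₁) (B + coordSq i₂ j₂))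
      ≡⟨ trans (∑ₗ-cong Fk λ i₁ → ∑ₗ-cong Fk λ j₁ → trans (∑ₗ-cong Fk λ i₂ → ∑ₗ-*ˡ Fk c _) (∑ₗ-*ˡ Fk c _))
               (trans (∑ₗ-cong Fk λ i₁ → ∑ₗ-*ˡ Fk c _) (∑ₗ-*ˡ Fk c _)) ⟩
    c * (∑ₗ Fk λ i₁ → ∑ₗ Fk λ j₁ → ∑ₗ Fk λ i₂ → ∑ₗ Fk λ j₂ → normPairs k m (A + coordSq i₁ j₁) (B + coordSq i₂ j₂))
      ≤⟨ *-monoʳ-≤ c (∑ₗ-coordSq² k (λ a b → normPairs k m (A + a) (B + b))) ⟩
    c * (2 * k * (2 * k * normPairs k (suc m) A B))
      ≡⟨ rearrange (2 * k) c _ ⟩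
    2 * k * (2 * k * c) * normPairs k (suc m) A B
      ≡⟨ cong (λ e → (2 * k) ^ e * normPairs k (suc m) A B) (*-suc 2 m) ⟨
    (2 * k) ^ (2 * suc m) * normPairs k (suc m) A B ∎
  where
  open ≤-Reasoning
  rearrange : ∀ a c n → c * (a * (a * n)) ≡ a * (a * c) * n
  rearrange = solve-∀
  Fk = allFin k
  c = (2 * k) ^ (2 * m)

∑-shift-≤ : ∀ n a (G G' : ℕ → ℕ) → a < n → (∀ b → G b ≤ G' (a + b)) → ∑ n G ≤ ∑ (n + n) G'
∑-shift-≤ n a G G' a<n G≤G' = begin
    ∑ n G                            ≤⟨ ∑-mono n G≤G' ⟩
    ∑ n (λ b → G' (a + b))           ≤⟨ m≤n+m _ _ ⟩
    ∑ a G' + ∑ n (λ b → G' (a + b)) ≡⟨ ∑-split a n G' ⟨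
    ∑ (a + n) G'                     ≤⟨ ∑-mono-length G' (+-monoˡ-≤ n (<⇒≤ a<n)) ⟩
    ∑ (n + n) G'                     ∎
  where open ≤-Reasoning

-- With x = a + d, the condition A + ‖a‖² = B + ‖d‖² becomes the linear equation A + 2 x·a = B + ‖x‖².
sphere⇒plane : ∀ {A B} a₁ a₂ a₃ d₁ d₂ d₃ →
  A + a₁ * a₁ + a₂ * a₂ + a₃ * a₃ ≡ B + d₁ * d₁ + d₂ * d₂ + d₃ * d₃ →
  (a₁ + d₁) * a₁ + (a₂ + d₂) * a₂ + (a₃ + d₃) * a₃ ≡
    (B + ((a₁ + d₁) * (a₁ + d₁) + (a₂ + d₂) * (a₂ + d₂) + (a₃ + d₃) * (a₃ + d₃)) ∸ A) / 2
sphere⇒plane {A} {B} a₁ a₂ a₃ d₁ d₂ d₃ eq = half {A} (begin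
    A + 2 * ((a₁ + d₁) * a₁ + (a₂ + d₂) * a₂ + (a₃ + d₃) * a₃)  ≡⟨ expandˡ A a₁ a₂ a₃ d₁ d₂ d₃ ⟩
    A + a₁ * a₁ + a₂ * a₂ + a₃ * a₃ + K                          ≡⟨ cong (_+ K) eq ⟩
    B + d₁ * d₁ + d₂ * d₂ + d₃ * d₃ + K                          ≡⟨ expandʳ B a₁ a₂ a₃ d₁ d₂ d₃ ⟨
    B + ((a₁ + d₁) * (a₁ + d₁) + (a₂ + d₂) * (a₂ + d₂) + (a₃ + d₃) * (a₃ + d₃)) ∎)
  where
  open ≡-Reasoning
  K = a₁ * a₁ + a₂ * a₂ + a₃ * a₃ + 2 * (d₁ * a₁ + d₂ * a₂ + d₃ * a₃)
  expandˡ : ∀ A a₁ a₂ a₃ d₁ d₂ d₃ → A + 2 * ((a₁ + d₁) * a₁ + (a₂ + d₂) * a₂ + (a₃ + d₃) * a₃) ≡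
    A + a₁ * a₁ + a₂ * a₂ + a₃ * a₃ + (a₁ * a₁ + a₂ * a₂ + a₃ * a₃ + 2 * (d₁ * a₁ + d₂ * a₂ + d₃ * a₃))
  expandˡ = solve-∀
  expandʳ : ∀ B a₁ a₂ a₃ d₁ d₂ d₃ → B + ((a₁ + d₁) * (a₁ + d₁) + (a₂ + d₂) * (a₂ + d₂) + (a₃ + d₃) * (a₃ + d₃)) ≡
    B + d₁ * d₁ + d₂ * d₂ + d₃ * d₃ + (a₁ * a₁ + a₂ * a₂ + a₃ * a₃ + 2 * (d₁ * a₁ + d₂ * a₂ + d₃ * a₃))
  expandʳ = solve-∀

normPairs₃≤∑-linearCount : ∀ n A B → normPairs n 3 A B ≤
  ∑ (n + n) λ x₁ → ∑ (n + n) λ x₂ → ∑ (n + n) λ x₃ →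
    linearCount n ((B + (x₁ * x₁ + x₂ * x₂ + x₃ * x₃) ∸ A) / 2) x₁ x₂ x₃
normPairs₃≤∑-linearCount n A B = ≤-trans substitute (≤-reflexive reorder)
  where
  N = n + n
  Ψ : ℕ → ℕ → ℕ → ℕ → ℕ → ℕ → ℕ
  Ψ a₁ a₂ a₃ x₁ x₂ x₃ = 𝟙 (x₁ * a₁ + x₂ * a₂ + x₃ * a₃ ≟ (B + (x₁ * x₁ + x₂ * x₂ + x₃ * x₃) ∸ A) / 2)
  substitute : normPairs n 3 A B ≤ ∑ n λ a₁ → ∑ N λ x₁ → ∑ n λ a₂ → ∑ N λ x₂ → ∑ n λ a₃ → ∑ N λ x₃ → Ψ a₁ a₂ a₃ x₁ x₂ x₃
  substitute =
    ∑-mono-< n λ a₁ a₁<n → ∑-shift-≤ n a₁ _ _ a₁<n λ d₁ →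
    ∑-mono-< n λ a₂ a₂<n → ∑-shift-≤ n a₂ _ _ a₂<n λ d₂ →
    ∑-mono-< n λ a₃ a₃<n → ∑-shift-≤ n a₃ _ _ a₃<n λ d₃ →
    𝟙-mono (_ ≟ _) (_ ≟ _) (sphere⇒plane {A} {B} a₁ a₂ a₃ d₁ d₂ d₃)
  reorder : (∑ n λ a₁ → ∑ N λ x₁ → ∑ n λ a₂ → ∑ N λ x₂ → ∑ n λ a₃ → ∑ N λ x₃ → Ψ a₁ a₂ a₃ x₁ x₂ x₃) ≡
            (∑ N λ x₁ → ∑ N λ x₂ → ∑ N λ x₃ → ∑ n λ a₁ → ∑ n λ a₂ → ∑ n λ a₃ → Ψ a₁ a₂ a₃ x₁ x₂ x₃)
  reorder =
    trans (∑-comm n N _) (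
    trans (∑-cong N λ x₁ → ∑-cong n λ a₁ → ∑-comm n N _) (
    trans (∑-cong N λ x₁ → ∑-comm n N _) (
    trans (∑-cong N λ x₁ → ∑-cong N λ x₂ → ∑-cong n λ a₁ → ∑-cong n λ a₂ → ∑-comm n N _) (
    trans (∑-cong N λ x₁ → ∑-cong N λ x₂ → ∑-cong n λ a₁ → ∑-comm n N _) (
    ∑-cong N λ x₁ → ∑-cong N λ x₂ → ∑-comm n N _)))))

linearBound : (n x₁ x₂ x₃ : ℕ) → ℕ
linearBound n x₁ x₂ zero       = n * (n * (n * 1))
linearBound n x₁ x₂ x₃@(suc _) = (n * n * gcd x₁ (gcd x₂ x₃)) / x₃ + (2 * n + 1)

linearCount≤linearBound : ∀ n c x₁ x₂ x₃ → linearCount n c x₁ x₂ x₃ ≤ linearBound n x₁ x₂ x₃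
linearCount≤linearBound n c x₁ x₂ zero =
  ∑-≤-const n _ λ a₁ _ → ∑-≤-const n _ λ a₂ _ → ∑-≤-const n _ λ a₃ _ → 𝟙≤1 (x₁ * a₁ + x₂ * a₂ + 0 * a₃ ≟ c)
linearCount≤linearBound n c x₁ x₂ x₃@(suc _) = begin
    C                ≤⟨ m≤n+m∸n C b ⟩
    b + (C ∸ b)      ≤⟨ +-monoʳ-≤ b (m*n≤o⇒m≤o/n (C ∸ b) x₃ _ [C∸b]x₃≤) ⟩
    b + G / x₃       ≡⟨ +-comm b _ ⟩
    G / x₃ + b       ∎
  where
  open ≤-Reasoning
  C = linearCount n c x₁ x₂ x₃
  b = 2 * n + 1
  G = n * n * gcd x₁ (gcd x₂ x₃)
  [C∸b]x₃≤ : (C ∸ b) * x₃ ≤ G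
  [C∸b]x₃≤ = begin
    (C ∸ b) * x₃      ≡⟨ *-distribʳ-∸ x₃ C b ⟩
    C * x₃ ∸ b * x₃   ≤⟨ ∸-monoˡ-≤ (b * x₃) (linearCount-bound n c x₁ x₂ x₃) ⟩
    G + b * x₃ ∸ b * x₃ ≡⟨ m+n∸n≡m G (b * x₃) ⟩
    G                 ∎

linearCount-swap₂₃ : ∀ n c x₁ x₂ x₃ → linearCount n c x₁ x₂ x₃ ≡ linearCount n c x₁ x₃ x₂
linearCount-swap₂₃ n c x₁ x₂ x₃ = ∑-cong n λ a₁ → trans (∑-comm n n _) (∑-cong n λ a₃ → ∑-cong n λ a₂ →
  cong (λ L → 𝟙 (L ≟ c)) (+-right-comm (x₁ * a₁) (x₂ * a₂) (x₃ * a₃)))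

linearCount-rotate : ∀ n c x₁ x₂ x₃ → linearCount n c x₁ x₂ x₃ ≡ linearCount n c x₂ x₃ x₁
linearCount-rotate n c x₁ x₂ x₃ = trans (∑-comm n n _) (trans (∑-cong n λ a₂ → ∑-comm n n _) (∑-cong n λ a₂ → ∑-cong n λ a₃ → ∑-cong n λ a₁ →
  cong (λ L → 𝟙 (L ≟ c)) (rotate (x₁ * a₁) (x₂ * a₂) (x₃ * a₃))))
  where rotate : ∀ p q r → p + q + r ≡ q + r + p
        rotate p q r = trans (+-assoc p q r) (+-comm p (q + r))

maxLastBound : (n x₁ x₂ x₃ : ℕ) → ℕ
maxLastBound n x₁ x₂ x₃ = 𝟙 (x₁ ≤? x₃) * 𝟙 (x₂ ≤? x₃) * linearBound n x₁ x₂ x₃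

linearCount≤maxLastBound : ∀ n c {x₁ x₂ x₃} → x₁ ≤ x₃ → x₂ ≤ x₃ → linearCount n c x₁ x₂ x₃ ≤ maxLastBound n x₁ x₂ x₃
linearCount≤maxLastBound n c {x₁} {x₂} {x₃} x₁≤x₃ x₂≤x₃ = begin
    linearCount n c x₁ x₂ x₃                        ≤⟨ linearCount≤linearBound n c x₁ x₂ x₃ ⟩
    linearBound n x₁ x₂ x₃                          ≡⟨ *-identityˡ _ ⟨
    1 * 1 * linearBound n x₁ x₂ x₃                  ≡⟨ cong₂ (λ u v → u * v * linearBound n x₁ x₂ x₃)
                                                         (𝟙-yes (x₁ ≤? x₃) x₁≤x₃) (𝟙-yes (x₂ ≤? x₃) x₂≤x₃) ⟨
    maxLastBound n x₁ x₂ x₃                         ∎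
  where open ≤-Reasoning

linearCount≤∑-maxLastBound : ∀ n c x₁ x₂ x₃ →
  linearCount n c x₁ x₂ x₃ ≤ maxLastBound n x₁ x₂ x₃ + maxLastBound n x₁ x₃ x₂ + maxLastBound n x₂ x₃ x₁
linearCount≤∑-maxLastBound n c x₁ x₂ x₃ = byLargest (≤-total x₁ x₃) (≤-total x₂ x₃) (≤-total x₁ x₂)
  where
  C = linearCount n c x₁ x₂ x₃
  B₃ = maxLastBound n x₁ x₂ x₃
  B₂ = maxLastBound n x₁ x₃ x₂
  B₁ = maxLastBound n x₂ x₃ x₁
  largest₃ : x₁ ≤ x₃ → x₂ ≤ x₃ → C ≤ B₃ + B₂ + B₁
  largest₃ x₁≤x₃ x₂≤x₃ = ≤-trans (linearCount≤maxLastBound n c x₁≤x₃ x₂≤x₃) (≤-trans (m≤m+n B₃ B₂) (m≤m+n _ B₁))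
  largest₂ : x₁ ≤ x₂ → x₃ ≤ x₂ → C ≤ B₃ + B₂ + B₁
  largest₂ x₁≤x₂ x₃≤x₂ = ≤-trans (≤-trans (≤-reflexive (linearCount-swap₂₃ n c x₁ x₂ x₃)) (linearCount≤maxLastBound n c x₁≤x₂ x₃≤x₂))
                                 (≤-trans (m≤n+m B₂ B₃) (m≤m+n _ B₁))
  largest₁ : x₂ ≤ x₁ → x₃ ≤ x₁ → C ≤ B₃ + B₂ + B₁
  largest₁ x₂≤x₁ x₃≤x₁ = ≤-trans (≤-trans (≤-reflexive (linearCount-rotate n c x₁ x₂ x₃)) (linearCount≤maxLastBound n c x₂≤x₁ x₃≤x₁))
                                 (m≤n+m B₁ (B₃ + B₂))
  byLargest : x₁ ≤ x₃ ⊎ x₃ ≤ x₁ → x₂ ≤ x₃ ⊎ x₃ ≤ x₂ → x₁ ≤ x₂ ⊎ x₂ ≤ x₁ → C ≤ B₃ + B₂ + B₁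
  byLargest (inj₁ x₁≤x₃) (inj₁ x₂≤x₃) _            = largest₃ x₁≤x₃ x₂≤x₃
  byLargest _            (inj₂ x₃≤x₂) (inj₁ x₁≤x₂) = largest₂ x₁≤x₂ x₃≤x₂
  byLargest (inj₁ x₁≤x₃) (inj₂ x₃≤x₂) (inj₂ _)     = largest₂ (≤-trans x₁≤x₃ x₃≤x₂) x₃≤x₂
  byLargest (inj₂ x₃≤x₁) _            (inj₂ x₂≤x₁) = largest₁ x₂≤x₁ x₃≤x₁
  byLargest (inj₂ x₃≤x₁) (inj₁ x₂≤x₃) (inj₁ x₁≤x₂) = largest₃ (≤-trans x₁≤x₂ x₂≤x₃) x₂≤x₃

∑³ : ℕ → (ℕ → ℕ → ℕ → ℕ) → ℕ
∑³ N f = ∑ N λ x₁ → ∑ N λ x₂ → ∑ N λ x₃ → f x₁ x₂ x₃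

∑³-mono : ∀ N {f g : ℕ → ℕ → ℕ → ℕ} → (∀ x₁ x₂ x₃ → f x₁ x₂ x₃ ≤ g x₁ x₂ x₃) → ∑³ N f ≤ ∑³ N g
∑³-mono N le = ∑-mono N λ x₁ → ∑-mono N λ x₂ → ∑-mono N λ x₃ → le x₁ x₂ x₃

∑³-+ : ∀ N (f g : ℕ → ℕ → ℕ → ℕ) → ∑³ N (λ x₁ x₂ x₃ → f x₁ x₂ x₃ + g x₁ x₂ x₃) ≡ ∑³ N f + ∑³ N g
∑³-+ N f g = trans (∑-cong N λ x₁ → trans (∑-cong N λ x₂ → ∑-+ N _ _) (∑-+ N _ _)) (∑-+ N _ _)

∑³-swap₂₃ : ∀ N (f : ℕ → ℕ → ℕ → ℕ) → ∑³ N (λ x₁ x₂ x₃ → f x₁ x₃ x₂) ≡ ∑³ N f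
∑³-swap₂₃ N f = ∑-cong N λ x₁ → ∑-comm N N _

∑³-rotate : ∀ N (f : ℕ → ℕ → ℕ → ℕ) → ∑³ N (λ x₁ x₂ x₃ → f x₂ x₃ x₁) ≡ ∑³ N f
∑³-rotate N f = trans (∑-comm N N _) (∑-cong N λ x₂ → ∑-comm N N _)

∑³-linearCount≤ : ∀ N n (c : ℕ → ℕ → ℕ → ℕ) →
  ∑³ N (λ x₁ x₂ x₃ → linearCount n (c x₁ x₂ x₃) x₁ x₂ x₃) ≤ 3 * ∑³ N (maxLastBound n)
∑³-linearCount≤ N n c = begin
    ∑³ N (λ x₁ x₂ x₃ → linearCount n (c x₁ x₂ x₃) x₁ x₂ x₃)
      ≤⟨ ∑³-mono N (λ x₁ x₂ x₃ → linearCount≤∑-maxLastBound n (c x₁ x₂ x₃) x₁ x₂ x₃) ⟩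
    ∑³ N (λ x₁ x₂ x₃ → B x₁ x₂ x₃ + B x₁ x₃ x₂ + B x₂ x₃ x₁)
      ≡⟨ trans (∑³-+ N _ _) (cong (_+ ∑³ N (λ x₁ x₂ x₃ → B x₂ x₃ x₁)) (∑³-+ N _ _)) ⟩
    ∑³ N B + ∑³ N (λ x₁ x₂ x₃ → B x₁ x₃ x₂) + ∑³ N (λ x₁ x₂ x₃ → B x₂ x₃ x₁)
      ≡⟨ cong₂ (λ u v → ∑³ N B + u + v) (∑³-swap₂₃ N B) (∑³-rotate N B) ⟩
    ∑³ N B + ∑³ N B + ∑³ N B
      ≡⟨ thrice (∑³ N B) ⟩
    3 * ∑³ N B ∎
  where
  open ≤-Reasoning
  B = maxLastBound n
  thrice : ∀ q → q + q + q ≡ 3 * q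
  thrice = solve-∀

-- Divisor sums

𝟙∣-spaced : ∀ d N → Spaced d N (λ x → 𝟙 (d ∣? x))
𝟙∣-spaced d N {t} {t'} t≤t' _ dt dt' =
  ∣m+n∣m⇒∣n (subst (d ∣_) (sym (m+[n∸m]≡n t≤t')) (𝟙-witness (d ∣? t') dt')) (𝟙-witness (d ∣? t) dt)

∑-𝟙∣-bound : ∀ N d .{{_ : NonZero d}} → d * ∑ N (λ x → 𝟙 (d ∣? x)) ≤ N + d
∑-𝟙∣-bound N d = spaced-∑-bound d N _ (λ x → 𝟙≤1 (d ∣? x)) (𝟙∣-spaced d N)

∑-𝟙∣≤2N/d : ∀ N d .{{_ : NonZero d}} → d ≤ N → ∑ N (λ x → 𝟙 (d ∣? x)) ≤ 2 * (N / d)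
∑-𝟙∣≤2N/d N d d≤N = begin
    ∑ N (λ x → 𝟙 (d ∣? x)) ≤⟨ m*n≤o⇒m≤o/n _ d (N + d) (subst (_≤ N + d) (*-comm d _) (∑-𝟙∣-bound N d)) ⟩
    (N + d) / d            ≡⟨ m/n≡1+[m∸n]/n (m≤n+m d N) ⟩
    1 + (N + d ∸ d) / d    ≡⟨ cong (λ x → 1 + x / d) (m+n∸n≡m N d) ⟩
    1 + N / d              ≤⟨ +-monoˡ-≤ (N / d) (m≥n⇒m/n>0 d≤N) ⟩
    N / d + N / d          ≡⟨ cong (N / d +_) (+-identityʳ _) ⟨
    2 * (N / d)            ∎
  where open ≤-Reasoning

-- The discrete form of 1/(D+1)² ≤ 1/D - 1/(D+1); summed, it telescopes to ∑ (N/d)² ≤ 2N².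
[N/[D+1]]²+N²/[D+1]≤N²/D : ∀ N D .{{_ : NonZero D}} →
  (N / suc D) * (N / suc D) + (N * N) / suc D ≤ (N * N) / D
[N/[D+1]]²+N²/[D+1]≤N²/D N D = m*n≤o⇒m≤o/n _ D (N * N) (begin
    (q * q + r) * D           ≡⟨ *-distribʳ-+ D (q * q) r ⟩
    q * q * D + r * D         ≤⟨ +-monoˡ-≤ (r * D) (*-monoʳ-≤ (q * q) (n≤1+n D)) ⟩
    q * q * suc D + r * D     ≤⟨ +-monoˡ-≤ (r * D) q²[D+1]≤r ⟩
    r + r * D                 ≡⟨ *-suc r D ⟨
    r * suc D                 ≤⟨ m/n*n≤m (N * N) (suc D) ⟩
    N * N                     ∎)
  where
  open ≤-Reasoning
  q = N / suc D
  r = (N * N) / suc D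
  q²[D+1]≤r : q * q * suc D ≤ r
  q²[D+1]≤r = m*n≤o⇒m≤o/n _ (suc D) (N * N) (begin
    q * q * suc D * suc D           ≡⟨ interchange′ q (suc D) ⟩
    (q * suc D) * (q * suc D)       ≤⟨ *-mono-≤ (m/n*n≤m N (suc D)) (m/n*n≤m N (suc D)) ⟩
    N * N                           ∎)
    where interchange′ : ∀ q d → q * q * d * d ≡ (q * d) * (q * d)
          interchange′ = solve-∀

∑-[N/d]²+N²/[D+1]≤2N² : ∀ N D → ∑ (suc D) (λ d' → (N / suc d') * (N / suc d')) + (N * N) / suc D ≤ 2 * (N * N)
∑-[N/d]²+N²/[D+1]≤2N² N zero = ≤-reflexive (begin
    (N / 1) * (N / 1) + 0 + (N * N) / 1 ≡⟨ cong₂ _+_ (trans (+-identityʳ _) (cong₂ _*_ (n/1≡n N) (n/1≡n N))) (n/1≡n (N * N)) ⟩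
    N * N + N * N                     ≡⟨ cong (N * N +_) (+-identityʳ _) ⟨
    2 * (N * N)                       ∎)
  where open ≡-Reasoning
∑-[N/d]²+N²/[D+1]≤2N² N (suc D) = begin
    ∑ (suc (suc D)) f + (N * N) / suc (suc D)         ≡⟨ cong (λ l → ∑ l f + (N * N) / suc (suc D)) (+-comm 1 (suc D)) ⟩
    ∑ (suc D + 1) f + (N * N) / suc (suc D)           ≡⟨ cong (_+ (N * N) / suc (suc D)) (trans (∑-split (suc D) 1 f) (cong (∑ (suc D) f +_) last)) ⟩
    ∑ (suc D) f + f (suc D) + (N * N) / suc (suc D)   ≡⟨ +-assoc (∑ (suc D) f) _ _ ⟩
    ∑ (suc D) f + (f (suc D) + (N * N) / suc (suc D)) ≤⟨ +-monoʳ-≤ (∑ (suc D) f) ([N/[D+1]]²+N²/[D+1]≤N²/D N (suc D)) ⟩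
    ∑ (suc D) f + (N * N) / suc D                     ≤⟨ ∑-[N/d]²+N²/[D+1]≤2N² N D ⟩
    2 * (N * N)                                       ∎
  where
  open ≤-Reasoning
  f : ℕ → ℕ
  f d' = (N / suc d') * (N / suc d')
  last : ∑ 1 (λ i → f (suc D + i)) ≡ f (suc D)
  last = trans (+-identityʳ _) (cong f (+-identityʳ (suc D)))

∑-[N/d]²≤2N² : ∀ N → ∑ N (λ d' → (N / suc d') * (N / suc d')) ≤ 2 * (N * N)
∑-[N/d]²≤2N² zero    = z≤n
∑-[N/d]²≤2N² (suc N) = ≤-trans (m≤m+n _ _) (∑-[N/d]²+N²/[D+1]≤2N² (suc N) N)

∑-𝟙≤-prefix : ∀ N c (f : ℕ → ℕ) → ∑ N (λ x → 𝟙 (x ≤? c) * f x) ≤ ∑ (suc c) f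
∑-𝟙≤-prefix N c f = begin
    ∑ N g                                   ≤⟨ ∑-mono-length g (m≤n+m N (suc c)) ⟩
    ∑ (suc c + N) g                         ≡⟨ ∑-split (suc c) N g ⟩
    ∑ (suc c) g + ∑ N (λ i → g (suc c + i)) ≡⟨ cong (∑ (suc c) g +_) (trans (∑-cong N beyond) (∑-zero N)) ⟩
    ∑ (suc c) g + 0                         ≡⟨ +-identityʳ _ ⟩
    ∑ (suc c) g                             ≤⟨ ∑-mono (suc c) (λ x → ≤-trans (*-monoˡ-≤ (f x) (𝟙≤1 (x ≤? c))) (≤-reflexive (+-identityʳ (f x)))) ⟩
    ∑ (suc c) f                             ∎
  where
  open ≤-Reasoning
  g = λ x → 𝟙 (x ≤? c) * f x
  beyond : ∀ i → g (suc c + i) ≡ 0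
  beyond i = cong (_* f (suc c + i)) (𝟙-no (suc c + i ≤? c) (λ le → 1+n≰n (≤-trans (m≤m+n (suc c) i) le)))

multiplesUpTo : (N c d : ℕ) → ℕ
multiplesUpTo N c d = ∑ N (λ x → 𝟙 (x ≤? c) * 𝟙 (d ∣? x))

multiplesUpTo≤ : ∀ N j d .{{_ : NonZero j}} .{{_ : NonZero d}} → multiplesUpTo N (j * d) d ≤ 3 * j
multiplesUpTo≤ N j d = *-cancelˡ-≤ d (begin
    d * multiplesUpTo N (j * d) d      ≤⟨ *-monoʳ-≤ d (∑-𝟙≤-prefix N (j * d) (λ x → 𝟙 (d ∣? x))) ⟩
    d * ∑ (suc (j * d)) (λ x → 𝟙 (d ∣? x)) ≤⟨ ∑-𝟙∣-bound (suc (j * d)) d ⟩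
    suc (j * d) + d                    ≤⟨ +-monoˡ-≤ d (+-monoˡ-≤ (j * d) (>-nonZero⁻¹ d)) ⟩
    d + j * d + d                      ≤⟨ +-monoˡ-≤ d (+-monoˡ-≤ (j * d) (m≤m*n d j)) ⟩
    d * j + j * d + d                  ≤⟨ +-monoʳ-≤ (d * j + j * d) (m≤m*n d j) ⟩
    d * j + j * d + d * j              ≡⟨ collect d j ⟩
    d * (3 * j)                        ∎)
  where
  open ≤-Reasoning
  collect : ∀ d j → d * j + j * d + d * j ≡ d * (3 * j)
  collect = solve-∀

divisorTerm≤ : ∀ N n x₃ d .{{_ : NonZero x₃}} .{{_ : NonZero d}} →
  let e = multiplesUpTo N x₃ d in
  e * (e * (𝟙 (d ∣? x₃) * ((n * n * d) / x₃))) ≤ 9 * (n * n) * (𝟙 (d ∣? x₃) * (x₃ / d))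
divisorTerm≤ N n x₃ d with d ∣? x₃
... | no _ = ≤-trans (≤-reflexive (trans (cong (e *_) (*-zeroʳ e)) (*-zeroʳ e))) z≤n
  where e = multiplesUpTo N x₃ d
... | yes (divides j refl) = begin
    e * (e * (1 * V))            ≡⟨ cong (λ v → e * (e * v)) (*-identityˡ V) ⟩
    e * (e * V)                  ≤⟨ *-mono-≤ e≤ (*-monoˡ-≤ V e≤) ⟩
    3 * j * (3 * j * V)          ≡⟨ regroup j V ⟩
    9 * j * (V * j)              ≤⟨ *-monoʳ-≤ (9 * j) (≤-trans (≤-reflexive (cong (_* j) V≡)) (m/n*n≤m (n * n) j)) ⟩
    9 * j * (n * n)              ≡⟨ *-right-comm 9 j (n * n) ⟩
    9 * (n * n) * j              ≡⟨ cong (9 * (n * n) *_) (trans (sym (m*n/n≡m j d)) (sym (*-identityˡ _))) ⟩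
    9 * (n * n) * (1 * (j * d / d)) ∎
  where
  open ≤-Reasoning
  instance
    j≢0 : NonZero j
    j≢0 = m*n≢0⇒m≢0 j
  e = multiplesUpTo N (j * d) d
  V = (n * n * d) / (j * d)
  V≡ : V ≡ (n * n) / j
  V≡ = m*n/o*n≡m/o (n * n) d j
  e≤ : e ≤ 3 * j
  e≤ = multiplesUpTo≤ N j d
  regroup : ∀ j V → 3 * j * (3 * j * V) ≡ 9 * j * (V * j)
  regroup = solve-∀

term≤∑-suc : ∀ N (F : ℕ → ℕ) d .{{_ : NonZero d}} → d ≤ N → F d ≤ ∑ N (F ∘ suc)
term≤∑-suc N F (suc d') d≤N = term≤∑ N (F ∘ suc) d≤N

gcd/x₃≤∑-divisors : ∀ N n x₁ x₂ x₃ .{{_ : NonZero x₃}} → x₃ < N →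
  (n * n * gcd x₁ (gcd x₂ x₃)) / x₃ ≤
  ∑ N (λ d' → 𝟙 (suc d' ∣? x₁) * (𝟙 (suc d' ∣? x₂) * (𝟙 (suc d' ∣? x₃) * ((n * n * suc d') / x₃))))
gcd/x₃≤∑-divisors N n x₁ x₂ x₃ x₃<N = begin
    (n * n * g) / x₃  ≡⟨ term-at-gcd ⟨
    F g               ≤⟨ term≤∑-suc N F g (<⇒≤ (≤-<-trans g≤x₃ x₃<N)) ⟩
    ∑ N (F ∘ suc)     ∎
  where
  open ≤-Reasoning
  h = gcd x₂ x₃
  g = gcd x₁ h
  instance
    h≢0 : NonZero h
    h≢0 = gcd≢0ʳ x₂ x₃
    g≢0 : NonZero g
    g≢0 = gcd≢0ʳ x₁ h
  F : ℕ → ℕ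
  F d = 𝟙 (d ∣? x₁) * (𝟙 (d ∣? x₂) * (𝟙 (d ∣? x₃) * ((n * n * d) / x₃)))
  g≤x₃ : g ≤ x₃
  g≤x₃ = ≤-trans (gcd[m,n]≤n x₁ h) (gcd[m,n]≤n x₂ x₃)
  term-at-gcd : F g ≡ (n * n * g) / x₃
  term-at-gcd = begin-equality
    F g                                ≡⟨ cong₂ (λ u v → u * (v * (𝟙 (g ∣? x₃) * ((n * n * g) / x₃))))
                                            (𝟙-yes (g ∣? x₁) (gcd[m,n]∣m x₁ h))
                                            (𝟙-yes (g ∣? x₂) (∣-trans (gcd[m,n]∣n x₁ h) (gcd[m,n]∣m x₂ x₃))) ⟩
    1 * (1 * (𝟙 (g ∣? x₃) * ((n * n * g) / x₃))) ≡⟨ cong (λ u → 1 * (1 * (u * ((n * n * g) / x₃))))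
                                                       (𝟙-yes (g ∣? x₃) (∣-trans (gcd[m,n]∣n x₁ h) (gcd[m,n]∣n x₂ x₃))) ⟩
    1 * (1 * (1 * ((n * n * g) / x₃)))            ≡⟨ trans (*-identityˡ _) (trans (*-identityˡ _) (*-identityˡ _)) ⟩
    (n * n * g) / x₃                              ∎

gcdMass : (N n x₃ : ℕ) .{{_ : NonZero x₃}} → ℕ
gcdMass N n x₃ = ∑ N λ x₁ → ∑ N λ x₂ → 𝟙 (x₁ ≤? x₃) * 𝟙 (x₂ ≤? x₃) * ((n * n * gcd x₁ (gcd x₂ x₃)) / x₃)

gcdMass≤ : ∀ N n x₃ .{{_ : NonZero x₃}} → x₃ < N →
  gcdMass N n x₃ ≤ ∑ N (λ d' → 9 * (n * n) * (𝟙 (suc d' ∣? x₃) * (x₃ / suc d')))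
gcdMass≤ N n x₃ x₃<N = begin
    gcdMass N n x₃
      ≤⟨ ∑-mono N (λ x₁ → ∑-mono N λ x₂ → *-monoʳ-≤ (m x₁ * m x₂) (gcd/x₃≤∑-divisors N n x₁ x₂ x₃ x₃<N)) ⟩
    ∑ N (λ x₁ → ∑ N λ x₂ → m x₁ * m x₂ * ∑ N λ d' → δ d' x₁ * (δ d' x₂ * (δ d' x₃ * V d')))
      ≡⟨ ∑-cong N (λ x₁ → ∑-cong N λ x₂ → trans (sym (∑-*ˡ N (m x₁ * m x₂) _)) (∑-cong N λ d' → regroup (m x₁) (m x₂) (δ d' x₁) (δ d' x₂) _)) ⟩
    ∑ N (λ x₁ → ∑ N λ x₂ → ∑ N λ d' → (m x₁ * δ d' x₁) * ((m x₂ * δ d' x₂) * (δ d' x₃ * V d')))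
      ≡⟨ trans (∑-cong N (λ x₁ → ∑-comm N N _)) (∑-comm N N _) ⟩
    ∑ N (λ d' → ∑ N λ x₁ → ∑ N λ x₂ → (m x₁ * δ d' x₁) * ((m x₂ * δ d' x₂) * (δ d' x₃ * V d')))
      ≡⟨ ∑-cong N (λ d' → trans (∑-cong N λ x₁ → trans (∑-*ˡ N (m x₁ * δ d' x₁) _) (cong ((m x₁ * δ d' x₁) *_) (∑-*ʳ N (δ d' x₃ * V d') _))) (∑-*ʳ N _ _)) ⟩
    ∑ N (λ d' → e d' * (e d' * (δ d' x₃ * V d')))
      ≤⟨ ∑-mono N (λ d' → divisorTerm≤ N n x₃ (suc d')) ⟩
    ∑ N (λ d' → 9 * (n * n) * (δ d' x₃ * (x₃ / suc d'))) ∎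
  where
  open ≤-Reasoning
  m : ℕ → ℕ
  m x = 𝟙 (x ≤? x₃)
  δ : ℕ → ℕ → ℕ
  δ d' x = 𝟙 (suc d' ∣? x)
  V : ℕ → ℕ
  V d' = (n * n * suc d') / x₃
  e : ℕ → ℕ
  e d' = multiplesUpTo N x₃ (suc d')
  regroup : ∀ a b c f w → a * b * (c * (f * w)) ≡ (a * c) * ((b * f) * w)
  regroup = solve-∀

∑-quotients-of-multiples≤ : ∀ N d .{{_ : NonZero d}} → d ≤ N → ∑ N (λ t → 𝟙 (d ∣? t) * (t / d)) ≤ 2 * ((N / d) * (N / d))
∑-quotients-of-multiples≤ N d d≤N = begin
    ∑ N (λ t → 𝟙 (d ∣? t) * (t / d))   ≤⟨ ∑-mono-< N (λ t t<N → *-monoʳ-≤ (𝟙 (d ∣? t)) (/-monoˡ-≤ d (<⇒≤ t<N))) ⟩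
    ∑ N (λ t → 𝟙 (d ∣? t) * (N / d))   ≡⟨ ∑-*ʳ N (N / d) _ ⟩
    ∑ N (λ t → 𝟙 (d ∣? t)) * (N / d)   ≤⟨ *-monoˡ-≤ (N / d) (∑-𝟙∣≤2N/d N d d≤N) ⟩
    2 * (N / d) * (N / d)               ≡⟨ *-assoc 2 (N / d) (N / d) ⟩
    2 * ((N / d) * (N / d))             ∎
  where open ≤-Reasoning

∑-gcdMass≤ : ∀ N n → ∑ N (λ x₃ → gcdMass (suc N) n (suc x₃)) ≤ 9 * (n * n) * (2 * (2 * (suc N * suc N)))
∑-gcdMass≤ N n = begin
    ∑ N (λ x₃ → gcdMass N′ n (suc x₃))
      ≤⟨ ∑-mono-< N (λ x₃ x₃<N → gcdMass≤ N′ n (suc x₃) (s<s x₃<N)) ⟩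
    ∑ N (λ x₃ → ∑ N′ λ d' → 9 * (n * n) * q d' (suc x₃))
      ≡⟨ ∑-comm N N′ (λ x₃ d' → 9 * (n * n) * q d' (suc x₃)) ⟩
    ∑ N′ (λ d' → ∑ N λ x₃ → 9 * (n * n) * q d' (suc x₃))
      ≡⟨ ∑-cong N′ (λ d' → ∑-*ˡ N (9 * (n * n)) (λ x₃ → q d' (suc x₃))) ⟩
    ∑ N′ (λ d' → 9 * (n * n) * ∑ N (λ x₃ → q d' (suc x₃)))
      ≤⟨ ∑-mono-< N′ (λ d' d'<N′ → *-monoʳ-≤ (9 * (n * n))
           (≤-trans (m≤n+m _ (q d' 0)) (∑-quotients-of-multiples≤ N′ (suc d') d'<N′))) ⟩
    ∑ N′ (λ d' → 9 * (n * n) * (2 * ((N′ / suc d') * (N′ / suc d'))))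
      ≡⟨ trans (∑-*ˡ N′ (9 * (n * n)) (λ d' → 2 * ((N′ / suc d') * (N′ / suc d'))))
               (cong (9 * (n * n) *_) (∑-*ˡ N′ 2 (λ d' → (N′ / suc d') * (N′ / suc d')))) ⟩
    9 * (n * n) * (2 * ∑ N′ (λ d' → (N′ / suc d') * (N′ / suc d')))
      ≤⟨ *-monoʳ-≤ (9 * (n * n)) (*-monoʳ-≤ 2 (∑-[N/d]²≤2N² N′)) ⟩
    9 * (n * n) * (2 * (2 * (N′ * N′))) ∎
  where
  open ≤-Reasoning
  N′ = suc N
  q : ℕ → ℕ → ℕ
  q d' t = 𝟙 (suc d' ∣? t) * (t / suc d')

∑³-maxLastBound≤ : ∀ N n → ∑³ (suc N) (maxLastBound n) ≤
  n * (n * (n * 1)) + (N * (suc N * (suc N * (2 * n + 1))) + 9 * (n * n) * (2 * (2 * (suc N * suc N))))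
∑³-maxLastBound≤ N n = begin
    ∑³ (suc N) (maxLastBound n)                      ≡⟨ ∑³-rotate (suc N) (maxLastBound n) ⟨
    R 0 + ∑ N (R ∘ suc)                             ≤⟨ +-mono-≤ R0≤ (∑-mono N R-suc≤) ⟩
    c + ∑ N (λ x₃ → suc N * (suc N * b) + gcdMass (suc N) n (suc x₃))
      ≡⟨ cong (c +_) (trans (∑-+ N _ _) (cong (_+ ∑ N (λ x₃ → gcdMass (suc N) n (suc x₃))) (∑-const N _))) ⟩
    c + (N * (suc N * (suc N * b)) + ∑ N (λ x₃ → gcdMass (suc N) n (suc x₃)))
      ≤⟨ +-monoʳ-≤ c (+-monoʳ-≤ (N * (suc N * (suc N * b))) (∑-gcdMass≤ N n)) ⟩
    c + (N * (suc N * (suc N * b)) + 9 * (n * n) * (2 * (2 * (suc N * suc N)))) ∎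
  where
  open ≤-Reasoning
  b = 2 * n + 1
  c = n * (n * (n * 1))
  R : ℕ → ℕ
  R x₃ = ∑ (suc N) λ x₁ → ∑ (suc N) λ x₂ → maxLastBound n x₁ x₂ x₃
  R0≤ : R 0 ≤ c
  R0≤ = begin
    R 0  ≡⟨ ∑-cong (suc N) (λ x₁ → trans (∑-cong (suc N) λ x₂ → *-assoc (𝟙 (x₁ ≤? 0)) (𝟙 (x₂ ≤? 0)) c) (∑-*ˡ (suc N) (𝟙 (x₁ ≤? 0)) (λ x₂ → 𝟙 (x₂ ≤? 0) * c))) ⟩
    ∑ (suc N) (λ x₁ → 𝟙 (x₁ ≤? 0) * ∑ (suc N) (λ x₂ → 𝟙 (x₂ ≤? 0) * c))  ≤⟨ ≤-trans (∑-𝟙≤-prefix (suc N) 0 (λ _ → ∑ (suc N) (λ x₂ → 𝟙 (x₂ ≤? 0) * c))) (≤-reflexive (+-identityʳ _)) ⟩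
    ∑ (suc N) (λ x₂ → 𝟙 (x₂ ≤? 0) * c)                                ≤⟨ ≤-trans (∑-𝟙≤-prefix (suc N) 0 (λ _ → c)) (≤-reflexive (+-identityʳ _)) ⟩
    c    ∎
  R-suc≤ : ∀ x₃ → R (suc x₃) ≤ suc N * (suc N * b) + gcdMass (suc N) n (suc x₃)
  R-suc≤ x₃ = begin
    R (suc x₃)                                               ≡⟨ ∑-cong (suc N) (λ x₁ → trans (∑-cong (suc N) λ x₂ → *-distribˡ-+ (m x₁ x₂) (G x₁ x₂ / suc x₃) b)
                                                                                   (∑-+ (suc N) (λ x₂ → m x₁ x₂ * (G x₁ x₂ / suc x₃)) (λ x₂ → m x₁ x₂ * b))) ⟩
    ∑ (suc N) (λ x₁ → ∑ (suc N) (λ x₂ → m x₁ x₂ * (G x₁ x₂ / suc x₃)) + ∑ (suc N) (λ x₂ → m x₁ x₂ * b))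
                                                             ≡⟨ ∑-+ (suc N) (λ x₁ → ∑ (suc N) (λ x₂ → m x₁ x₂ * (G x₁ x₂ / suc x₃))) (λ x₁ → ∑ (suc N) (λ x₂ → m x₁ x₂ * b)) ⟩
    gcdMass (suc N) n (suc x₃) + ∑ (suc N) (λ x₁ → ∑ (suc N) (λ x₂ → m x₁ x₂ * b))
                                                             ≤⟨ +-monoʳ-≤ (gcdMass (suc N) n (suc x₃))
                                                                  (∑-≤-const (suc N) _ λ x₁ _ → ∑-≤-const (suc N) b λ x₂ _ → m*b≤b x₁ x₂) ⟩
    gcdMass (suc N) n (suc x₃) + suc N * (suc N * b)         ≡⟨ +-comm _ (suc N * (suc N * b)) ⟩
    suc N * (suc N * b) + gcdMass (suc N) n (suc x₃)         ∎
    where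
    m : ℕ → ℕ → ℕ
    m x₁ x₂ = 𝟙 (x₁ ≤? suc x₃) * 𝟙 (x₂ ≤? suc x₃)
    G : ℕ → ℕ → ℕ
    G x₁ x₂ = n * n * gcd x₁ (gcd x₂ (suc x₃))
    m*b≤b : ∀ x₁ x₂ → m x₁ x₂ * b ≤ b
    m*b≤b x₁ x₂ = ≤-trans (*-monoˡ-≤ b (*-mono-≤ (𝟙≤1 (x₁ ≤? suc x₃)) (𝟙≤1 (x₂ ≤? suc x₃)))) (≤-reflexive (+-identityʳ b))

∑³-maxLastBound≤169n⁴ : ∀ n .{{_ : NonZero n}} → ∑³ (n + n) (maxLastBound n) ≤ 169 * n ^ 4
∑³-maxLastBound≤169n⁴ n@(suc n') = begin
    ∑³ (n + n) (maxLastBound n)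
      ≤⟨ ∑³-maxLastBound≤ (n' + n) n ⟩
    n * (n * (n * 1)) + ((n' + n) * ((n + n) * ((n + n) * (2 * n + 1))) + 9 * (n * n) * (2 * (2 * ((n + n) * (n + n)))))
      ≤⟨ +-mono-≤ (*-monoʳ-≤ n (*-monoʳ-≤ n (*-monoʳ-≤ n (s≤s z≤n))))
                  (+-monoˡ-≤ _ (*-mono-≤ (+-monoˡ-≤ n (n≤1+n n')) (*-monoʳ-≤ (n + n) (*-monoʳ-≤ (n + n) (2n+1≤3n n'))))) ⟩
    n * (n * (n * n)) + ((n + n) * ((n + n) * ((n + n) * (3 * n))) + 9 * (n * n) * (2 * (2 * ((n + n) * (n + n)))))
      ≡⟨ collect n ⟩
    169 * n ^ 4 ∎
  where
  open ≤-Reasoning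
  2n+1≤3n : ∀ n' → 2 * suc n' + 1 ≤ 3 * suc n'
  2n+1≤3n n' = subst (2 * suc n' + 1 ≤_) (pad n') (m≤m+n _ n')
    where pad : ∀ n' → 2 * suc n' + 1 + n' ≡ 3 * suc n'
          pad = solve-∀
  collect : ∀ n → n * (n * (n * n)) + ((n + n) * ((n + n) * ((n + n) * (3 * n))) + 9 * (n * n) * (2 * (2 * ((n + n) * (n + n)))))
                  ≡ 169 * (n * (n * (n * (n * 1))))
  collect = solve-∀

shiftedE2₃≤ : ∀ k .{{_ : NonZero k}} A B → shiftedE2 3 k A B ≤ 32448 * k ^ 10
shiftedE2₃≤ k A B = begin
    shiftedE2 3 k A B                                   ≤⟨ shiftedE2≤normPairs 3 k A B ⟩
    (2 * k) ^ 6 * normPairs k 3 A B                     ≤⟨ *-monoʳ-≤ ((2 * k) ^ 6) (normPairs₃≤∑-linearCount k A B) ⟩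
    (2 * k) ^ 6 * ∑³ (k + k) (λ x₁ x₂ x₃ → linearCount k (c x₁ x₂ x₃) x₁ x₂ x₃)
                                                        ≤⟨ *-monoʳ-≤ ((2 * k) ^ 6) (∑³-linearCount≤ (k + k) k c) ⟩
    (2 * k) ^ 6 * (3 * ∑³ (k + k) (maxLastBound k))     ≤⟨ *-monoʳ-≤ ((2 * k) ^ 6) (*-monoʳ-≤ 3 (∑³-maxLastBound≤169n⁴ k)) ⟩
    (2 * k) ^ 6 * (3 * (169 * k ^ 4))                   ≡⟨ cong (_* (3 * (169 * k ^ 4))) (^-distribʳ-* 2 k 6) ⟩
    2 ^ 6 * k ^ 6 * (3 * (169 * k ^ 4))                 ≡⟨ collect (2 ^ 6) (k ^ 6) (k ^ 4) ⟩
    32448 * (k ^ 6 * k ^ 4)                             ≡⟨ cong (32448 *_) (^-distribˡ-+-* k 6 4) ⟨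
    32448 * k ^ 10                                      ∎
  where
  open ≤-Reasoning
  c : ℕ → ℕ → ℕ → ℕ
  c x₁ x₂ x₃ = (B + (x₁ * x₁ + x₂ * x₂ + x₃ * x₃) ∸ A) / 2
  collect : ∀ a x y → a * x * (3 * (169 * y)) ≡ a * 507 * (x * y)
  collect = solve-∀

shiftedE2≤ : ∀ j k .{{_ : NonZero k}} A B → shiftedE2 (3 + j) k A B ≤ 32448 * k ^ (10 + 4 * j)
shiftedE2≤ zero    k A B = shiftedE2₃≤ k A B
shiftedE2≤ (suc j) k A B = begin
    shiftedE2 (suc (3 + j)) k A B         ≤⟨ shiftedE2-suc-≤ (3 + j) k _ (shiftedE2≤ j k) A B ⟩
    k ^ 4 * (32448 * k ^ (10 + 4 * j))    ≡⟨ x∙yz≈y∙xz (k ^ 4) 32448 _ ⟩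
    32448 * (k ^ 4 * k ^ (10 + 4 * j))    ≡⟨ cong (32448 *_) (^-distribˡ-+-* k 4 (10 + 4 * j)) ⟨
    32448 * k ^ (4 + (10 + 4 * j))        ≡⟨ cong (λ e → 32448 * k ^ e) (exponent j) ⟩
    32448 * k ^ (10 + 4 * suc j)          ∎
  where
  open ≤-Reasoning
  exponent : ∀ j → 4 + (10 + 4 * j) ≡ 10 + 4 * suc j
  exponent = solve-∀

energy-upper : ∀ j k .{{_ : NonZero k}} → E2 (3 + j) k ≤ 32448 * k ^ (10 + 4 * j)
energy-upper j k = subst (_≤ 32448 * k ^ (10 + 4 * j)) (sym (E2≡shiftedE2 (3 + j) k)) (shiftedE2≤ j k 0 0)

energy-lower : ∀ m k e .{{_ : NonZero k}} → 2 + e ≡ 4 * m → k ^ e ≤ suc m * E2 m k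
energy-lower m k e 2+e≡4m = *-cancelˡ-≤ (k * k) {{m*n≢0 k k}} (begin
    k * k * k ^ e                      ≡⟨ cong (_* k ^ e) (cong (k *_) (*-identityʳ k)) ⟨
    k ^ 2 * k ^ e                      ≡⟨ ^-distribˡ-+-* k 2 e ⟨
    k ^ (2 + e)                        ≡⟨ cong (k ^_) 2+e≡4m ⟩
    k ^ (4 * m)                        ≡⟨ ^-4* k m ⟩
    (k ^ m * k ^ m) * (k ^ m * k ^ m)  ≤⟨ energy-lower-bound m k (suc (m * (k * k))) (λ p q → s≤s (sqDist≤ p q)) ⟩
    suc (m * (k * k)) * E2 m k         ≤⟨ *-monoˡ-≤ (E2 m k) (+-monoˡ-≤ (m * (k * k)) (>-nonZero⁻¹ (k * k) {{m*n≢0 k k}})) ⟩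
    (k * k + m * (k * k)) * E2 m k     ≡⟨ factor (k * k) m (E2 m k) ⟩
    k * k * (suc m * E2 m k)           ∎)
  where
  open ≤-Reasoning
  factor : ∀ s m E → (s + m * s) * E ≡ s * (suc m * E)
  factor = solve-∀

-- The scale k with k^m ≤ N < (k+1)^m is within a factor 2 of N^(1/m).
sandwich : ∀ m e k N E a b .{{_ : NonZero k}} → k ^ m ≤ N → N < suc k ^ m → k ^ e ≤ a * E → E ≤ b * k ^ e →
  (N ^ e ≤ (2 ^ m) ^ e * a ^ m * E ^ m) × (E ^ m ≤ b ^ m * N ^ e)
sandwich m e k N E a b kᵐ≤N N<[k+1]ᵐ kᵉ≤aE E≤bkᵉ = lower , upper
  where
  open ≤-Reasoning
  lower : N ^ e ≤ (2 ^ m) ^ e * a ^ m * E ^ m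
  lower = begin
    N ^ e                        ≤⟨ ^-monoˡ-≤ e (≤-trans (<⇒≤ N<[k+1]ᵐ) (^-monoˡ-≤ m (+-monoˡ-≤ k (>-nonZero⁻¹ k)))) ⟩
    ((k + k) ^ m) ^ e            ≡⟨ cong (λ x → (x ^ m) ^ e) (cong (k +_) (+-identityʳ k)) ⟨
    ((2 * k) ^ m) ^ e            ≡⟨ cong (_^ e) (^-distribʳ-* 2 k m) ⟩
    (2 ^ m * k ^ m) ^ e          ≡⟨ ^-distribʳ-* (2 ^ m) (k ^ m) e ⟩
    (2 ^ m) ^ e * (k ^ m) ^ e    ≡⟨ cong ((2 ^ m) ^ e *_) (^-swap k m e) ⟩
    (2 ^ m) ^ e * (k ^ e) ^ m    ≤⟨ *-monoʳ-≤ ((2 ^ m) ^ e) (^-monoˡ-≤ m kᵉ≤aE) ⟩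
    (2 ^ m) ^ e * (a * E) ^ m    ≡⟨ cong ((2 ^ m) ^ e *_) (^-distribʳ-* a E m) ⟩
    (2 ^ m) ^ e * (a ^ m * E ^ m) ≡⟨ *-assoc ((2 ^ m) ^ e) (a ^ m) (E ^ m) ⟨
    (2 ^ m) ^ e * a ^ m * E ^ m  ∎
  upper : E ^ m ≤ b ^ m * N ^ e
  upper = begin
    E ^ m                  ≤⟨ ^-monoˡ-≤ m E≤bkᵉ ⟩
    (b * k ^ e) ^ m        ≡⟨ ^-distribʳ-* b (k ^ e) m ⟩
    b ^ m * (k ^ e) ^ m    ≡⟨ cong (b ^ m *_) (^-swap k e m) ⟩
    b ^ m * (k ^ m) ^ e    ≤⟨ *-monoʳ-≤ (b ^ m) (^-monoˡ-≤ e kᵐ≤N) ⟩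
    b ^ m * N ^ e          ∎

corollary4p2 : (m : ℕ) → 3 ≤ m →
    Σ ℕ λ c₁ → Σ ℕ λ c₂ → 0 < c₁ × 0 < c₂ ×
      ((N k : ℕ) → 1 ≤ N → k ^ m ≤ N → N < suc k ^ m →
        (N ^ (4 * m ∸ 2) ≤ c₁ * E2 m k ^ m) × (E2 m k ^ m ≤ c₂ * N ^ (4 * m ∸ 2)))
corollary4p2 m 3≤m with m≤n⇒∃[o]m+o≡n 3≤m
... | j , refl = c₁ , c₂ , c₁>0 , m^n>0 32448 m , bounds
  where
  e = 4 * m ∸ 2
  4m≡2+[10+4j] : ∀ j → 4 * (3 + j) ≡ 2 + (10 + 4 * j)
  4m≡2+[10+4j] = solve-∀
  e≡10+4j : e ≡ 10 + 4 * j
  e≡10+4j = trans (cong (_∸ 2) (4m≡2+[10+4j] j)) (m+n∸m≡n 2 _)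
  2+e≡4m : 2 + e ≡ 4 * m
  2+e≡4m = trans (cong (2 +_) e≡10+4j) (sym (4m≡2+[10+4j] j))
  c₁ = (2 ^ m) ^ e * suc m ^ m
  c₂ = 32448 ^ m
  c₁>0 : 0 < c₁
  c₁>0 = >-nonZero⁻¹ c₁ {{m*n≢0 _ _ {{m^n≢0 (2 ^ m) e {{m^n≢0 2 m}}}} {{m^n≢0 (suc m) m}}}}
  bounds : (N k : ℕ) → 1 ≤ N → k ^ m ≤ N → N < suc k ^ m →
    (N ^ e ≤ c₁ * E2 m k ^ m) × (E2 m k ^ m ≤ c₂ * N ^ e)
  bounds N zero    1≤N _ N<1 = ⊥-elim (<⇒≱ (subst (N <_) (^-zeroˡ m) N<1) 1≤N)
  bounds N (suc k) _   kᵐ≤N N<[k+1]ᵐ = sandwich m e (suc k) N (E2 m (suc k)) (suc m) 32448 kᵐ≤N N<[k+1]ᵐ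
    (energy-lower m (suc k) e 2+e≡4m)
    (subst (λ x → E2 m (suc k) ≤ 32448 * suc k ^ x) (sym e≡10+4j) (energy-upper j (suc k)))
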